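{- In the setting below, let $P$ be a disjoint $S$--$T$ path of $G$ and $B$ a common base of $(A_1,A_2)$ with $P\subseteq B$. Then $\operatorname{sgn}P=(-1)^k\det A_1[B]\det A_2[B]$.
   Context: $G=(V,E)$ is an undirected graph; $S=\{s_1,\dots,s_k\}$ and $T=\{t_1,\dots,t_k\}$ are disjoint vertex subsets; $\tilde V=V\setminus(S\cup T)$. A disjoint $S$--$T$ path is an edge set $P$ that is the union of $k$ pairwise vertex-disjoint paths $P_1,\dots,P_k$ with $P_i$ joining $s_i$ and $t_{\sigma_P(i)}$ for a permutation $\sigma_P$ of $\{1,\dots,k\}$; $\operatorname{sgn}P=\operatorname{sgn}\sigma_P$. $G^*$ is obtained from $G$ by adding a new vertex $v^*$ and the edge set $E'=\{\{v,v^*\}:v\in\tilde V\}$; $E^*=E\cup E'$. $A$ is the incidence matrix of an arbitrary orientation of $G^*$ (entry $+1$ at the tail, $-1$ at the head, $0$ otherwise). $A_1=A[S\cup\tilde V,E^*]$ and $A_2=A[T\cup\tilde V,E^*]$, where the rows of $A_1$ are ordered $s_1,\dots,s_k$ followed by $\tilde V$, the rows of $A_2$ are ordered $t_1,\dots,t_k$ followed by $\tilde V$ in the same order, and both have the same column order. A common base is a set $B\subseteq E^*$ with $A_1[B]$ and $A_2[B]$ square and nonsingular. -}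

module Defs where

open import Data.Nat using (ℕ; zero; suc; _+_; _<ᵇ_)
open import Data.Integer using (ℤ; +_; -_) renaming (_+_ to _+ℤ_; _*_ to _*ℤ_)
open import Data.Fin using (Fin; zero; suc; toℕ; splitAt; punchIn; fromℕ; inject₁; _≟_)
open import Data.Fin.Permutation using (Permutation′; _⟨$⟩ʳ_)
open import Data.List using (List; map; foldr)
open import Data.Nat.ListAction using (sum)
open import Data.List.Base using (allFin)
open import Data.Bool using (Bool; true; false; if_then_else_; _∧_)
open import Data.Sum using (_⊎_; inj₁; inj₂; [_,_])
open import Data.Product using (Σ; ∃; _×_; _,_)
open import Relation.Nullary using (¬_; does)
open import Relation.Binary.PropositionalEquality using (_≡_; _≢_)

negOnePow : ℕ → ℤ
negOnePow zero    = + 1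
negOnePow (suc n) = - negOnePow n

sumℤ : List ℤ → ℤ
sumℤ = foldr _+ℤ_ (+ 0)

det : ∀ {r} → (Fin r → Fin r → ℤ) → ℤ
det {zero}  M = + 1
det {suc r} M = sumℤ (map (λ j → negOnePow (toℕ j) *ℤ (M zero j *ℤ det {r} (λ a c → M (suc a) (punchIn j c))))
                          (allFin (suc r)))

inversions : ∀ {k} → (Fin k → Fin k) → ℕ
inversions {k} f =
  sum (map (λ i → sum (map (λ j → if (toℕ i <ᵇ toℕ j) ∧ (toℕ (f j) <ᵇ toℕ (f i)) then 1 else 0)
                               (allFin k)))
           (allFin k))

sgnPerm : ∀ {k} → Permutation′ k → ℤ
sgnPerm σ = negOnePow (inversions (σ ⟨$⟩ʳ_))

-- V = Fin n.  S = {s_1..s_k}, T = {t_1..t_k}.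
-- Ṽ = V \ (S ∪ T) is enumerated (in an arbitrary fixed order) by u : Fin m → Fin n.
-- G has edges indexed by Fin e, the arbitrary orientation being tail/head.
-- The edges of E' = {{u i, v*}} are indexed by Fin m; dir i = true means u i is the tail.
record Setting : Set where
  field
    n k m e : ℕ
    s t  : Fin k → Fin n
    u    : Fin m → Fin n
    tail head : Fin e → Fin n
    dir  : Fin m → Bool
    s-inj : ∀ a c → s a ≡ s c → a ≡ c
    t-inj : ∀ a c → t a ≡ t c → a ≡ c
    ST-disj : ∀ a c → s a ≢ t c
    u-inj : ∀ i j → u i ≡ u j → i ≡ j
    u-notS : ∀ i a → u i ≢ s a
    u-notT : ∀ i a → u i ≢ t a
    u-onto : ∀ v → (∀ a → v ≢ s a) → (∀ a → v ≢ t a) → ∃ λ i → u i ≡ v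
    loopless : ∀ l → tail l ≢ head l
    simple : ∀ l l' → ((tail l ≡ tail l' × head l ≡ head l') ⊎ (tail l ≡ head l' × head l ≡ tail l')) → l ≡ l'

module _ (𝒮 : Setting) where
  open Setting 𝒮

  Edge* : Set
  Edge* = Fin e ⊎ Fin m

  joins : Fin e → Fin n → Fin n → Set
  joins l x y = (tail l ≡ x × head l ≡ y) ⊎ (tail l ≡ y × head l ≡ x)

  -- incidence matrix entry of G* at a vertex w ∈ V (row v* is never used)
  inc : Fin n → Edge* → ℤ
  inc w (inj₁ l) = if does (w ≟ tail l) then + 1 else (if does (w ≟ head l) then - (+ 1) else + 0)
  inc w (inj₂ i) = if does (w ≟ u i) then (if dir i then + 1 else - (+ 1)) else + 0

  row₁ : Fin (k + m) → Fin n
  row₁ i = [ s , u ] (splitAt k i)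

  row₂ : Fin (k + m) → Fin n
  row₂ i = [ t , u ] (splitAt k i)

  A₁[_] : (Fin (k + m) → Edge*) → Fin (k + m) → Fin (k + m) → ℤ
  A₁[ b ] i j = inc (row₁ i) (b j)

  A₂[_] : (Fin (k + m) → Edge*) → Fin (k + m) → Fin (k + m) → ℤ
  A₂[ b ] i j = inc (row₂ i) (b j)

  -- A common base B ⊆ E*, given as an injective enumeration b of B in column order
  -- (|B| = k + m is forced by squareness).
  record CommonBase : Set where
    field
      b : Fin (k + m) → Edge*
      b-inj : ∀ i j → b i ≡ b j → i ≡ j
      nonsing₁ : det A₁[ b ] ≢ + 0
      nonsing₂ : det A₂[ b ] ≢ + 0

  record DisjointSTPath : Set where
    field
      σ : Permutation′ k
      len : Fin k → ℕ
      vert : (i : Fin k) → Fin (suc (len i)) → Fin n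
      start : ∀ i → vert i zero ≡ s i
      end : ∀ i → vert i (fromℕ (len i)) ≡ t (σ ⟨$⟩ʳ i)
      adj : ∀ i (a : Fin (len i)) → ∃ λ l → joins l (vert i (inject₁ a)) (vert i (suc a))
      distinct : ∀ (x y : Σ (Fin k) (λ i → Fin (suc (len i)))) →
                 (let (i , a) = x ; (j , c) = y in vert i a ≡ vert j c) → x ≡ y

    inP : Fin e → Set
    inP l = ∃ λ i → ∃ λ (a : Fin (len i)) → joins l (vert i (inject₁ a)) (vert i (suc a))

    sgn : ℤ
    sgn = sgnPerm σ

  _⊆B_ : DisjointSTPath → CommonBase → Set
  P ⊆B B = ∀ l → DisjointSTPath.inP P l → ∃ λ j → CommonBase.b B j ≡ inj₁ l

-- Let d = det A₂[B]. The columns of A₂[B] are columns of an incidence matrix whose rows are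
-- labelled injectively, so A₂[B] is totally unimodular and d² = 1. By Cramer's rule there is,
-- for each i, an integral vector ψᵢ with ψᵢ · A₂[B] = d · (row of sᵢ). Read on vertices and
-- shifted by -d at sᵢ, ψᵢ is a potential that is constant along every edge of B ∩ E, hence along
-- every path of P ⊆ B. Comparing its values at sⱼ and t_σ(j) shows that, modulo the rows of Ṽ,
-- the row of sᵢ is minus the row of t_σ(i). Row operations and a row permutation then give
-- det A₁[B] = (-1)^k · sgn σ · d, and sgn P = (-1)^k det A₁[B] det A₂[B] follows from d² = 1.
module Submission where

open import Defs
open import Data.Integer using (ℤ) renaming (_*_ to _*ℤ_)
open import Relation.Binary.PropositionalEquality using (_≡_)

open import Data.Bool using (true; false; if_then_else_; _∧_)
open import Data.Empty using (⊥-elim)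
open import Data.Fin using (Fin; zero; suc; toℕ; fromℕ; inject₁; punchIn; punchOut; _≟_; splitAt; join; _↑ˡ_; _↑ʳ_)
open import Data.Fin.Induction using (<-weakInduction)
open import Data.Fin.Permutation using (Permutation′; _⟨$⟩ʳ_; remove; punchIn-permute)
open import Data.Fin.Properties
  using (suc-injective; any?; join-splitAt; toℕ-↑ˡ; toℕ-inject₁; toℕ≤pred[n]; punchInᵢ≢i; punchIn-injective; punchIn-punchOut)
open import Data.Integer using (+_; -_; _+_; _-_; _*_; _^_)
open import Data.Integer.Properties
  using ( +-0-abelianGroup; +-*-semiring; +-assoc; +-identityˡ; +-identityʳ; *-assoc; *-comm; *-identityˡ; *-identityʳ; *-zeroʳ
        ; neg-involutive; neg-distribˡ-*)
open import Data.Integer.Tactic.RingSolver using (solve-∀)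
import Data.List as List
open import Data.List using (map; tabulate; allFin)
open import Data.Nat as ℕ using (ℕ; zero; suc; _<ᵇ_)
import Data.Nat.ListAction as ℕ
open import Data.Nat.Properties using (1+n≢n)
import Data.Nat.Properties as ℕ
open import Data.Product using (Σ-syntax; ∃; _×_; _,_)
open import Data.Sum using (_⊎_; inj₁; inj₂; [_,_]; assocˡ)
open import Data.Sum.Properties using ([,]-∘; [,]-map)
import Data.Vec.Functional as Vec
open import Data.Vec.Functional using (Vector; updateAt; zipWith; removeAt; _++_)
open import Data.Vec.Functional.Properties
  using (updateAt-updates; updateAt-minimal; updateAt-id-local; updateAt-commutes; map-updateAt; ++-cong; lookup-++ˡ; lookup-++ʳ)
open import Function using (_∘_; id; const)
open import Function.Definitions using (Injective)
open import Relation.Binary.PropositionalEquality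
  using (refl; sym; trans; subst; cong; cong₂; cong-app; _≗_; _≢_; module ≡-Reasoning)
open import Relation.Nullary using (Dec; yes; no; does)
open import Relation.Nullary.Decidable using (dec-true; dec-false)

open import Algebra.Properties.AbelianGroup +-0-abelianGroup using (inverseʳ-unique)
open import Algebra.Properties.Semiring.Sum +-*-semiring
  using (sum; sum-syntax; sum-cong-≗; sum-remove; ∑-distrib-+; ∑-comm; ∑-permute; *-distribˡ-sum)
import Algebra.Properties.Semiring.Sum ℕ.+-*-semiring as ℕ∑

-- Finite sums

foldr-map-tabulate : ∀ {A B : Set} (_∙_ : B → B → B) (ε : B) {n} (f : A → B) (g : Fin n → A) →
  List.foldr _∙_ ε (map f (tabulate g)) ≡ Vec.foldr _∙_ ε (f ∘ g)
foldr-map-tabulate _∙_ ε {zero}  f g = refl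
foldr-map-tabulate _∙_ ε {suc n} f g = cong (f (g zero) ∙_) (foldr-map-tabulate _∙_ ε f (g ∘ suc))

sum-zero : ∀ {n} (f : Fin n → ℤ) → (∀ i → f i ≡ + 0) → sum f ≡ + 0
sum-zero {zero}  f f≡0 = refl
sum-zero {suc n} f f≡0 = cong₂ _+_ (f≡0 zero) (sum-zero (f ∘ suc) (f≡0 ∘ suc))

sum-single : ∀ {n} (f : Fin n → ℤ) i → (∀ j → j ≢ i → f j ≡ + 0) → sum f ≡ f i
sum-single f zero    f≡0 = trans (cong (_+_ (f zero)) (sum-zero _ λ j → f≡0 (suc j) λ ())) (+-identityʳ (f zero))
sum-single f (suc i) f≡0 =
  trans (cong₂ _+_ (f≡0 zero λ ()) (sum-single (f ∘ suc) i λ j j≢i → f≡0 (suc j) (j≢i ∘ suc-injective)))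
        (+-identityˡ (f (suc i)))

punchIn-preimage : ∀ {n} (p i : Fin (suc n)) → i ≢ p → Σ[ a ∈ Fin n ] punchIn p a ≡ i
punchIn-preimage p i i≢p = punchOut (i≢p ∘ sym) , punchIn-punchOut (i≢p ∘ sym)

punchIn-≢ : ∀ {n} (p : Fin (suc n)) {a a₀ i} → punchIn p a₀ ≡ i → a ≢ a₀ → punchIn p a ≢ i
punchIn-≢ p refl a≢a₀ eq = a≢a₀ (punchIn-injective p _ _ eq)

sum-pair : ∀ {n} (f : Fin n → ℤ) i i′ → i ≢ i′ → (∀ j → j ≢ i → j ≢ i′ → f j ≡ + 0) → sum f ≡ f i + f i′
sum-pair {suc n} f i i′ i≢i′ f≡0 with punchIn-preimage i i′ (i≢i′ ∘ sym)
... | a₀ , punchIn-a₀ = begin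
  sum f                     ≡⟨ sum-remove {i = i} f ⟩
  f i + sum (f ∘ punchIn i) ≡⟨ cong (_+_ (f i)) (sum-single (f ∘ punchIn i) a₀ λ a a≢a₀ →
                                 f≡0 (punchIn i a) (punchInᵢ≢i i a) (punchIn-≢ i punchIn-a₀ a≢a₀)) ⟩
  f i + f (punchIn i a₀)    ≡⟨ cong (λ j → f i + f j) punchIn-a₀ ⟩
  f i + f i′                ∎
  where open ≡-Reasoning

∑-linear : ∀ {n} a b (f g : Fin n → ℤ) → ∑[ i < n ] (a * f i + b * g i) ≡ a * sum f + b * sum g
∑-linear a b f g =
  trans (∑-distrib-+ (λ i → a * f i) (λ i → b * g i)) (sym (cong₂ _+_ (*-distribˡ-sum a f) (*-distribˡ-sum b g)))

∑-difference : ∀ {n} (f g : Fin n → ℤ) → ∑[ i < n ] (f i - g i) ≡ sum f - sum g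
∑-difference f g =
  trans (sum-cong-≗ λ i → as-combination (f i) (g i)) (trans (∑-linear (+ 1) (- + 1) f g) (sym (as-combination (sum f) (sum g))))
  where
  as-combination : ∀ x y → x - y ≡ + 1 * x + - + 1 * y
  as-combination = solve-∀

sum-split : ∀ {k m} (f : Fin (k ℕ.+ m) → ℤ) → sum f ≡ ∑[ a < k ] f (a ↑ˡ m) + ∑[ x < m ] f (k ↑ʳ x)
sum-split {zero}      f = sym (+-identityˡ (sum f))
sum-split {suc k} {m} f = begin
  f zero + sum (f ∘ suc)                                             ≡⟨ cong (_+_ (f zero)) (sum-split {k} {m} (f ∘ suc)) ⟩
  f zero + (∑[ a < k ] f (suc (a ↑ˡ m)) + ∑[ x < m ] f (suc k ↑ʳ x)) ≡⟨ sym (+-assoc (f zero) _ _) ⟩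
  f zero + ∑[ a < k ] f (suc (a ↑ˡ m)) + ∑[ x < m ] f (suc k ↑ʳ x)   ∎
  where open ≡-Reasoning

-- Determinants: expansion, multilinearity, alternation

Matrix : ℕ → Set
Matrix r = Vector (Vector ℤ r) r

alt : ∀ {n} → Fin n → ℤ
alt i = negOnePow (toℕ i)

minor : ∀ {r} → Matrix (suc r) → Fin (suc r) → Fin (suc r) → Matrix r
minor M i j a c = M (punchIn i a) (punchIn j c)

_ᵀ : ∀ {r} → Matrix r → Matrix r
(M ᵀ) i j = M j i

_[_]≔_ : ∀ {r} → Matrix r → Fin r → Vector ℤ r → Matrix r
M [ p ]≔ v = updateAt M p (const v)

det-expand-row₀ : ∀ {r} (M : Matrix (suc r)) → det M ≡ ∑[ j < suc r ] (alt j * (M zero j * det (minor M zero j)))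
det-expand-row₀ M = foldr-map-tabulate _+_ (+ 0) (λ j → alt j * (M zero j * det (minor M zero j))) id

det-cong : ∀ {r} (M N : Matrix r) → (∀ i j → M i j ≡ N i j) → det M ≡ det N
det-cong {zero}  M N M≡N = refl
det-cong {suc r} M N M≡N = begin
  det M                                                      ≡⟨ det-expand-row₀ M ⟩
  ∑[ j < suc r ] (alt j * (M zero j * det (minor M zero j))) ≡⟨ sum-cong-≗ (λ j → cong₂ (λ x d → alt j * (x * d))
                                                                  (M≡N zero j) (det-cong _ _ λ a c → M≡N (suc a) (punchIn j c))) ⟩
  ∑[ j < suc r ] (alt j * (N zero j * det (minor N zero j))) ≡⟨ sym (det-expand-row₀ N) ⟩
  det N                                                      ∎
  where open ≡-Reasoning

det-minor₀-updateAt-suc : ∀ {r} (M : Matrix (suc (suc r))) p v j →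
  det (minor (M [ suc p ]≔ v) zero j) ≡ det (minor M zero j [ p ]≔ (v ∘ punchIn j))
det-minor₀-updateAt-suc M p v j = det-cong (minor (M [ suc p ]≔ v) zero j) (minor M zero j [ p ]≔ (v ∘ punchIn j)) λ a c →
  cong-app (map-updateAt {f = _∘ punchIn j} (λ _ → refl) (M ∘ suc) p a) c

det-linear-row : ∀ {r} (M : Matrix r) p a b {v x y : Vector ℤ r} → (∀ j → v j ≡ a * x j + b * y j) →
  det (M [ p ]≔ v) ≡ a * det (M [ p ]≔ x) + b * det (M [ p ]≔ y)
det-linear-row {suc r} M zero a b {v} {x} {y} v≡ = begin
  det (M [ zero ]≔ v)
    ≡⟨ det-expand-row₀ (M [ zero ]≔ v) ⟩
  ∑[ j < suc r ] (alt j * (v j * D j))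
    ≡⟨ sum-cong-≗ (λ j → trans (cong (λ z → alt j * (z * D j)) (v≡ j)) (distrib a b (alt j) (x j) (y j) (D j))) ⟩
  ∑[ j < suc r ] (a * (alt j * (x j * D j)) + b * (alt j * (y j * D j)))
    ≡⟨ ∑-linear a b (λ j → alt j * (x j * D j)) (λ j → alt j * (y j * D j)) ⟩
  a * ∑[ j < suc r ] (alt j * (x j * D j)) + b * ∑[ j < suc r ] (alt j * (y j * D j))
    ≡⟨ sym (cong₂ (λ X Y → a * X + b * Y) (det-expand-row₀ (M [ zero ]≔ x)) (det-expand-row₀ (M [ zero ]≔ y))) ⟩
  a * det (M [ zero ]≔ x) + b * det (M [ zero ]≔ y)
    ∎
  where
  open ≡-Reasoning
  D : Fin (suc r) → ℤ
  D j = det (minor M zero j)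
  distrib : ∀ a b s x y d → s * ((a * x + b * y) * d) ≡ a * (s * (x * d)) + b * (s * (y * d))
  distrib = solve-∀
det-linear-row {suc (suc r)} M (suc p) a b {v} {x} {y} v≡ = begin
  det (M [ suc p ]≔ v)
    ≡⟨ det-expand-row₀ (M [ suc p ]≔ v) ⟩
  ∑[ j < suc (suc r) ] (alt j * (M zero j * det (minor (M [ suc p ]≔ v) zero j)))
    ≡⟨ sum-cong-≗ (λ j → trans (cong (λ z → alt j * (M zero j * z)) (minor-linear j))
                               (distrib a b (alt j) (M zero j) (X j) (Y j))) ⟩
  ∑[ j < suc (suc r) ] (a * (alt j * (M zero j * X j)) + b * (alt j * (M zero j * Y j)))
    ≡⟨ ∑-linear a b (λ j → alt j * (M zero j * X j)) (λ j → alt j * (M zero j * Y j)) ⟩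
  a * ∑[ j < suc (suc r) ] (alt j * (M zero j * X j)) + b * ∑[ j < suc (suc r) ] (alt j * (M zero j * Y j))
    ≡⟨ sym (cong₂ (λ X Y → a * X + b * Y) (det-expand-row₀ (M [ suc p ]≔ x)) (det-expand-row₀ (M [ suc p ]≔ y))) ⟩
  a * det (M [ suc p ]≔ x) + b * det (M [ suc p ]≔ y)
    ∎
  where
  open ≡-Reasoning
  X Y : Fin (suc (suc r)) → ℤ
  X j = det (minor (M [ suc p ]≔ x) zero j)
  Y j = det (minor (M [ suc p ]≔ y) zero j)
  minor-linear : ∀ j → det (minor (M [ suc p ]≔ v) zero j) ≡ a * X j + b * Y j
  minor-linear j = begin
    det (minor (M [ suc p ]≔ v) zero j)
      ≡⟨ det-minor₀-updateAt-suc M p v j ⟩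
    det (minor M zero j [ p ]≔ (v ∘ punchIn j))
      ≡⟨ det-linear-row (minor M zero j) p a b (v≡ ∘ punchIn j) ⟩
    a * det (minor M zero j [ p ]≔ (x ∘ punchIn j)) + b * det (minor M zero j [ p ]≔ (y ∘ punchIn j))
      ≡⟨ sym (cong₂ (λ z w → a * z + b * w) (det-minor₀-updateAt-suc M p x j) (det-minor₀-updateAt-suc M p y j)) ⟩
    a * X j + b * Y j
      ∎
  distrib : ∀ a b s m X Y → s * (m * (a * X + b * Y)) ≡ a * (s * (m * X)) + b * (s * (m * Y))
  distrib = solve-∀

det-expand-col₀ : ∀ {r} (M : Matrix (suc r)) → det M ≡ ∑[ i < suc r ] (alt i * (M i zero * det (minor M i zero)))
det-expand-col₀ {zero}  M = det-expand-row₀ M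
det-expand-col₀ {suc r} M = begin
  det M
    ≡⟨ det-expand-row₀ M ⟩
  T zero + ∑[ l < suc r ] (alt (suc l) * (M zero (suc l) * det (minor M zero (suc l))))
    ≡⟨ cong (_+_ (T zero)) (sum-cong-≗ λ l → trans
         (cong (λ z → alt (suc l) * (M zero (suc l) * z)) (det-expand-col₀ (minor M zero (suc l))))
         (*-distribˡ-sum² (alt (suc l)) (M zero (suc l)) (λ a → alt a * (M (suc a) zero * D l a)))) ⟩
  T zero + ∑[ l < suc r ] ∑[ a < suc r ] (alt (suc l) * (M zero (suc l) * (alt a * (M (suc a) zero * D l a))))
    ≡⟨ cong (_+_ (T zero)) (∑-comm (λ l a → alt (suc l) * (M zero (suc l) * (alt a * (M (suc a) zero * D l a))))) ⟩
  T zero + ∑[ a < suc r ] ∑[ l < suc r ] (alt (suc l) * (M zero (suc l) * (alt a * (M (suc a) zero * D l a))))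
    ≡⟨ cong (_+_ (T zero)) (sum-cong-≗ λ a → trans
         (sum-cong-≗ λ l → swap-signs (alt l) (alt a) (M zero (suc l)) (M (suc a) zero) (D l a))
         (sym (*-distribˡ-sum² (alt (suc a)) (M (suc a) zero) (λ l → alt l * (M zero (suc l) * D l a))))) ⟩
  T zero + ∑[ a < suc r ] (alt (suc a) * (M (suc a) zero * ∑[ l < suc r ] (alt l * (M zero (suc l) * D l a))))
    ≡⟨ cong (_+_ (T zero)) (sum-cong-≗ λ a →
         cong (λ z → alt (suc a) * (M (suc a) zero * z)) (sym (det-expand-row₀ (minor M (suc a) zero)))) ⟩
  ∑[ i < suc (suc r) ] T i
    ∎
  where
  open ≡-Reasoning
  T : Fin (suc (suc r)) → ℤ
  T i = alt i * (M i zero * det (minor M i zero))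
  -- definitionally also det (minor (minor M (suc a) zero) zero l): M without rows 0, a + 1 and columns 0, l + 1
  D : Fin (suc r) → Fin (suc r) → ℤ
  D l a = det (minor (minor M zero (suc l)) a zero)
  *-distribˡ-sum² : ∀ {n} c x (f : Fin n → ℤ) → c * (x * sum f) ≡ ∑[ i < n ] (c * (x * f i))
  *-distribˡ-sum² c x f = trans (cong (c *_) (*-distribˡ-sum x f)) (*-distribˡ-sum c (λ i → x * f i))
  swap-signs : ∀ sl sa A B d → (- sl) * (A * (sa * (B * d))) ≡ (- sa) * (B * (sl * (A * d)))
  swap-signs = solve-∀

det-transpose : ∀ {r} (M : Matrix r) → det (M ᵀ) ≡ det M
det-transpose {zero}  M = refl
det-transpose {suc r} M = begin
  det (M ᵀ)                                                    ≡⟨ det-expand-row₀ (M ᵀ) ⟩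
  ∑[ j < suc r ] (alt j * (M j zero * det (minor M j zero ᵀ))) ≡⟨ sum-cong-≗ (λ j →
                                                                    cong (λ z → alt j * (M j zero * z)) (det-transpose (minor M j zero))) ⟩
  ∑[ j < suc r ] (alt j * (M j zero * det (minor M j zero)))   ≡⟨ sym (det-expand-col₀ M) ⟩
  det M                                                        ∎
  where open ≡-Reasoning

cofactor-term-zero : ∀ s x {d} → d ≡ + 0 → s * (x * d) ≡ + 0
cofactor-term-zero s x refl = trans (cong (s *_) (*-zeroʳ x)) (*-zeroʳ s)

det-adjacent-equal-rows : ∀ {r} (M : Matrix (suc r)) p → M (inject₁ p) ≗ M (suc p) → det M ≡ + 0
det-adjacent-equal-rows {suc r} M zero M₀≗M₁ = begin
  det M                                                             ≡⟨ det-expand-col₀ M ⟩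
  + 1 * X zero + (- + 1 * X (suc zero) + ∑[ a < r ] T (suc (suc a))) ≡⟨ cong₂ (λ x y → + 1 * X zero + (- + 1 * x + y))
                                                                         X₁≡X₀ (sum-zero (λ a → T (suc (suc a))) vanish) ⟩
  + 1 * X zero + (- + 1 * X zero + + 0)                             ≡⟨ cancel (X zero) ⟩
  + 0                                                               ∎
  where
  open ≡-Reasoning
  X T : Fin (suc (suc r)) → ℤ
  X i = M i zero * det (minor M i zero)
  T i = alt i * X i
  X₁≡X₀ : X (suc zero) ≡ X zero
  X₁≡X₀ = cong₂ _*_ (sym (M₀≗M₁ zero))
    (det-cong (minor M (suc zero) zero) (minor M zero zero) λ { zero c → M₀≗M₁ (suc c) ; (suc a) c → refl })
  -- the match on a only exposes r = suc _, which the recursive call needs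
  minor-vanishes : ∀ a → det (minor M (suc (suc a)) zero) ≡ + 0
  minor-vanishes zero    = det-adjacent-equal-rows (minor M (suc (suc zero)) zero) zero (M₀≗M₁ ∘ suc)
  minor-vanishes (suc a) = det-adjacent-equal-rows (minor M (suc (suc (suc a))) zero) zero (M₀≗M₁ ∘ suc)
  vanish : ∀ a → T (suc (suc a)) ≡ + 0
  vanish a = cofactor-term-zero (alt (suc (suc a))) (M (suc (suc a)) zero) (minor-vanishes a)
  cancel : ∀ x → + 1 * x + (- + 1 * x + + 0) ≡ + 0
  cancel = solve-∀
det-adjacent-equal-rows {suc r} M (suc p) Mₚ≗Mₚ₊₁ = trans (det-expand-row₀ M) (sum-zero _ λ j →
  cofactor-term-zero (alt j) (M zero j) (det-adjacent-equal-rows (minor M zero j) p (Mₚ≗Mₚ₊₁ ∘ punchIn j)))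

suc≢inject₁ : ∀ {r} (p : Fin r) → suc p ≢ inject₁ p
suc≢inject₁ p p+1≡p = 1+n≢n (trans (cong toℕ p+1≡p) (toℕ-inject₁ p))

updateAdjacent : ∀ {r} → Matrix (suc r) → Fin r → Vector ℤ (suc r) → Vector ℤ (suc r) → Matrix (suc r)
updateAdjacent M p x y = (M [ suc p ]≔ y) [ inject₁ p ]≔ x

module _ {r} (M : Matrix (suc r)) (p : Fin r) where

  updateAdjacent-inject₁ : ∀ x y → updateAdjacent M p x y (inject₁ p) ≡ x
  updateAdjacent-inject₁ x y = updateAt-updates (inject₁ p) (M [ suc p ]≔ y)

  updateAdjacent-suc : ∀ x y → updateAdjacent M p x y (suc p) ≡ y
  updateAdjacent-suc x y = trans (updateAt-minimal (suc p) (inject₁ p) (M [ suc p ]≔ y) (suc≢inject₁ p)) (updateAt-updates (suc p) M)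

  updateAdjacent-other : ∀ x y i → i ≢ inject₁ p → i ≢ suc p → updateAdjacent M p x y i ≡ M i
  updateAdjacent-other x y i i≢p i≢p+1 =
    trans (updateAt-minimal i (inject₁ p) (M [ suc p ]≔ y) i≢p) (updateAt-minimal i (suc p) M i≢p+1)

  det-updateAdjacent : ∀ (X : Matrix (suc r)) x y → X (inject₁ p) ≗ x → X (suc p) ≗ y →
    (∀ i → i ≢ inject₁ p → i ≢ suc p → X i ≗ M i) → det X ≡ det (updateAdjacent M p x y)
  det-updateAdjacent X x y Xₚ≗x Xₚ₊₁≗y Xᵢ≗Mᵢ =
    det-cong X (updateAdjacent M p x y) λ i j → rows i j (i ≟ inject₁ p) (i ≟ suc p)
    where
    rows : ∀ i j → Dec (i ≡ inject₁ p) → Dec (i ≡ suc p) → X i j ≡ updateAdjacent M p x y i j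
    rows i j (yes refl) _          = trans (Xₚ≗x j) (sym (cong-app (updateAdjacent-inject₁ x y) j))
    rows i j (no _)     (yes refl) = trans (Xₚ₊₁≗y j) (sym (cong-app (updateAdjacent-suc x y) j))
    rows i j (no i≢p)   (no i≢p+1) = trans (Xᵢ≗Mᵢ i i≢p i≢p+1 j) (sym (cong-app (updateAdjacent-other x y i i≢p i≢p+1) j))

  det-updateAdjacent-equal : ∀ x → det (updateAdjacent M p x x) ≡ + 0
  det-updateAdjacent-equal x = det-adjacent-equal-rows (updateAdjacent M p x x) p λ j →
    trans (cong-app (updateAdjacent-inject₁ x x) j) (sym (cong-app (updateAdjacent-suc x x) j))

  det-updateAdjacent-+ˡ : ∀ x x′ y →
    det (updateAdjacent M p (zipWith _+_ x x′) y) ≡ det (updateAdjacent M p x y) + det (updateAdjacent M p x′ y)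
  det-updateAdjacent-+ˡ x x′ y =
    trans (det-linear-row (M [ suc p ]≔ y) (inject₁ p) (+ 1) (+ 1) (λ j → sym (cong₂ _+_ (*-identityˡ (x j)) (*-identityˡ (x′ j)))))
          (cong₂ _+_ (*-identityˡ (det (updateAdjacent M p x y))) (*-identityˡ (det (updateAdjacent M p x′ y))))

  det-updateAdjacent-+ʳ : ∀ x y y′ →
    det (updateAdjacent M p x (zipWith _+_ y y′)) ≡ det (updateAdjacent M p x y) + det (updateAdjacent M p x y′)
  det-updateAdjacent-+ʳ x y y′ = begin
    det (updateAdjacent M p x (zipWith _+_ y y′))
      ≡⟨ commute (zipWith _+_ y y′) ⟩
    det (N′ (zipWith _+_ y y′))
      ≡⟨ det-linear-row (M [ inject₁ p ]≔ x) (suc p) (+ 1) (+ 1)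
           (λ j → sym (cong₂ _+_ (*-identityˡ (y j)) (*-identityˡ (y′ j)))) ⟩
    + 1 * det (N′ y) + + 1 * det (N′ y′)
      ≡⟨ cong₂ _+_ (trans (*-identityˡ (det (N′ y))) (sym (commute y)))
                   (trans (*-identityˡ (det (N′ y′))) (sym (commute y′))) ⟩
    det (updateAdjacent M p x y) + det (updateAdjacent M p x y′)
      ∎
    where
    open ≡-Reasoning
    N′ : Vector ℤ (suc r) → Matrix (suc r)
    N′ z = (M [ inject₁ p ]≔ x) [ suc p ]≔ z
    commute : ∀ z → det (updateAdjacent M p x z) ≡ det (N′ z)
    commute z = det-cong (updateAdjacent M p x z) (N′ z) λ i →
      cong-app (updateAt-commutes (inject₁ p) (suc p) (suc≢inject₁ p ∘ sym) M i)

swapAdjacent : ∀ {r} → Fin r → Fin (suc r) → Fin (suc r)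
swapAdjacent zero    zero          = suc zero
swapAdjacent zero    (suc zero)    = zero
swapAdjacent zero    (suc (suc i)) = suc (suc i)
swapAdjacent (suc p) zero          = zero
swapAdjacent (suc p) (suc i)       = suc (swapAdjacent p i)

swapAdjacent-inject₁ : ∀ {r} (p : Fin r) → swapAdjacent p (inject₁ p) ≡ suc p
swapAdjacent-inject₁ zero    = refl
swapAdjacent-inject₁ (suc p) = cong suc (swapAdjacent-inject₁ p)

swapAdjacent-suc : ∀ {r} (p : Fin r) → swapAdjacent p (suc p) ≡ inject₁ p
swapAdjacent-suc zero    = refl
swapAdjacent-suc (suc p) = cong suc (swapAdjacent-suc p)

swapAdjacent-other : ∀ {r} (p : Fin r) i → i ≢ inject₁ p → i ≢ suc p → swapAdjacent p i ≡ i
swapAdjacent-other zero    zero          i≢p i≢p+1 = ⊥-elim (i≢p refl)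
swapAdjacent-other zero    (suc zero)    i≢p i≢p+1 = ⊥-elim (i≢p+1 refl)
swapAdjacent-other zero    (suc (suc i)) i≢p i≢p+1 = refl
swapAdjacent-other (suc p) zero          i≢p i≢p+1 = refl
swapAdjacent-other (suc p) (suc i)       i≢p i≢p+1 = cong suc (swapAdjacent-other p i (i≢p ∘ cong suc) (i≢p+1 ∘ cong suc))

swapAdjacent-punchIn : ∀ {r} (p : Fin r) a → swapAdjacent p (punchIn (inject₁ p) a) ≡ punchIn (suc p) a
swapAdjacent-punchIn zero    zero    = refl
swapAdjacent-punchIn zero    (suc a) = refl
swapAdjacent-punchIn (suc p) zero    = refl
swapAdjacent-punchIn (suc p) (suc a) = cong suc (swapAdjacent-punchIn p a)

-- Polarisation: 0 = det (a + b, a + b) = det (a, a) + det (a, b) + det (b, a) + det (b, b).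
det-swap-adjacent : ∀ {r} (M : Matrix (suc r)) p → det (M ∘ swapAdjacent p) ≡ - det M
det-swap-adjacent {r} M p = inverseʳ-unique (det M) (det (M ∘ swapAdjacent p)) (begin
  det M + det (M ∘ swapAdjacent p)
    ≡⟨ cong₂ _+_ (det-updateAdjacent M p M a b (λ _ → refl) (λ _ → refl) (λ _ _ _ _ → refl))
                 (det-updateAdjacent M p (M ∘ swapAdjacent p) b a (cong-app (cong M (swapAdjacent-inject₁ p)))
                   (cong-app (cong M (swapAdjacent-suc p))) λ i i≢p i≢p+1 → cong-app (cong M (swapAdjacent-other p i i≢p i≢p+1))) ⟩
  det (N a b) + det (N b a)
    ≡⟨ sym (cong₂ _+_ (trans (cong (_+ det (N a b)) (det-updateAdjacent-equal M p a)) (+-identityˡ (det (N a b))))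
                      (trans (cong (_+_ (det (N b a))) (det-updateAdjacent-equal M p b)) (+-identityʳ (det (N b a))))) ⟩
  (det (N a a) + det (N a b)) + (det (N b a) + det (N b b))
    ≡⟨ sym (cong₂ _+_ (det-updateAdjacent-+ʳ M p a a b) (det-updateAdjacent-+ʳ M p b a b)) ⟩
  det (N a (a ⊕ b)) + det (N b (a ⊕ b))
    ≡⟨ sym (det-updateAdjacent-+ˡ M p a b (a ⊕ b)) ⟩
  det (N (a ⊕ b) (a ⊕ b))
    ≡⟨ det-updateAdjacent-equal M p (a ⊕ b) ⟩
  + 0
    ∎)
  where
  open ≡-Reasoning
  _⊕_ : Vector ℤ (suc r) → Vector ℤ (suc r) → Vector ℤ (suc r)
  _⊕_ = zipWith _+_
  a b : Vector ℤ (suc r)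
  a = M (inject₁ p)
  b = M (suc p)
  N : Vector ℤ (suc r) → Vector ℤ (suc r) → Matrix (suc r)
  N = updateAdjacent M p

det-expand-row : ∀ {r} (p : Fin (suc r)) (M : Matrix (suc r)) →
  det M ≡ alt p * ∑[ j < suc r ] (alt j * (M p j * det (minor M p j)))
det-expand-row {r} = <-weakInduction Expansion base step
  where
  Expansion : Fin (suc r) → Set
  Expansion p = ∀ M → det M ≡ alt p * ∑[ j < suc r ] (alt j * (M p j * det (minor M p j)))
  base : Expansion zero
  base M = trans (det-expand-row₀ M) (sym (*-identityˡ (∑[ j < suc r ] (alt j * (M zero j * det (minor M zero j))))))
  step : ∀ q → Expansion (inject₁ q) → Expansion (suc q)
  step q expand M = begin
    det M
      ≡⟨ sym (neg-involutive (det M)) ⟩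
    - - det M
      ≡⟨ cong -_ (sym (det-swap-adjacent M q)) ⟩
    - det X
      ≡⟨ cong -_ (expand X) ⟩
    - (alt (inject₁ q) * ∑[ j < suc r ] (alt j * (X (inject₁ q) j * det (minor X (inject₁ q) j))))
      ≡⟨ cong₂ (λ s S → - (s * S)) (cong negOnePow (toℕ-inject₁ q)) (sum-cong-≗ λ j → cong₂ (λ x d → alt j * (x * d))
           (cong-app (cong M (swapAdjacent-inject₁ q)) j)
           (det-cong (minor X (inject₁ q) j) (minor M (suc q) j) λ a c → cong (λ i → M i (punchIn j c)) (swapAdjacent-punchIn q a))) ⟩
    - (alt q * ∑[ j < suc r ] (alt j * (M (suc q) j * det (minor M (suc q) j))))
      ≡⟨ neg-distribˡ-* (alt q) _ ⟩
    alt (suc q) * ∑[ j < suc r ] (alt j * (M (suc q) j * det (minor M (suc q) j)))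
      ∎
    where
    open ≡-Reasoning
    X : Matrix (suc r)
    X = M ∘ swapAdjacent q

det-equal-rows : ∀ {r} (M : Matrix r) p q → p ≢ q → M p ≗ M q → det M ≡ + 0
det-equal-rows₀ : ∀ {r} (M : Matrix (suc r)) q → M zero ≗ M (suc q) → det M ≡ + 0
det-equal-suc-rows : ∀ {r} (M : Matrix (suc r)) p q → p ≢ q → M (suc p) ≗ M (suc q) → det M ≡ + 0

det-equal-rows M zero    zero    p≢q Mₚ≗M_q = ⊥-elim (p≢q refl)
det-equal-rows M zero    (suc q) p≢q Mₚ≗M_q = det-equal-rows₀ M q Mₚ≗M_q
det-equal-rows M (suc p) zero    p≢q Mₚ≗M_q = det-equal-rows₀ M p (sym ∘ Mₚ≗M_q)
det-equal-rows M (suc p) (suc q) p≢q Mₚ≗M_q = det-equal-suc-rows M p q (p≢q ∘ cong suc) Mₚ≗M_q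

det-equal-rows₀ M zero    M₀≗M_q = det-adjacent-equal-rows M zero M₀≗M_q
det-equal-rows₀ M (suc q) M₀≗M_q = begin
  det M                         ≡⟨ sym (neg-involutive (det M)) ⟩
  - - det M                     ≡⟨ cong -_ (sym (det-swap-adjacent M zero)) ⟩
  - det (M ∘ swapAdjacent zero) ≡⟨ cong -_ (det-equal-suc-rows (M ∘ swapAdjacent zero) zero (suc q) (λ ()) M₀≗M_q) ⟩
  + 0                           ∎
  where open ≡-Reasoning

det-equal-suc-rows M p q p≢q Mₚ≗M_q = trans (det-expand-row₀ M) (sum-zero _ λ j →
  cofactor-term-zero (alt j) (M zero j) (det-equal-rows (minor M zero j) p q p≢q (Mₚ≗M_q ∘ punchIn j)))

det-zero-row : ∀ {r} (M : Matrix r) p → (∀ j → M p j ≡ + 0) → det M ≡ + 0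
det-zero-row {suc r} M p Mₚ≡0 = trans (det-expand-row p M) (trans (cong (alt p *_) (sum-zero _ λ j →
  trans (cong (λ x → alt j * (x * det (minor M p j))) (Mₚ≡0 j)) (*-zeroʳ (alt j)))) (*-zeroʳ (alt p)))

det-row-combination : ∀ {r n} (M : Matrix r) p (l : Fin n → ℤ) (w : Fin n → Vector ℤ r) →
  det (M [ p ]≔ (λ j → ∑[ q < n ] (l q * w q j))) ≡ ∑[ q < n ] (l q * det (M [ p ]≔ w q))
det-row-combination {n = zero}  M p l w = det-linear-row M p (+ 0) (+ 0) {x = M p} {y = M p} (λ _ → refl)
det-row-combination {n = suc n} M p l w = begin
  det (M [ p ]≔ (λ j → ∑[ q < suc n ] (l q * w q j)))
    ≡⟨ det-linear-row M p (l zero) (+ 1) (λ j → cong (_+_ (l zero * w zero j)) (sym (*-identityˡ _))) ⟩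
  l zero * det (M [ p ]≔ w zero) + + 1 * det (M [ p ]≔ (λ j → ∑[ q < n ] (l (suc q) * w (suc q) j)))
    ≡⟨ cong (_+_ (l zero * det (M [ p ]≔ w zero))) (trans (*-identityˡ _) (det-row-combination M p (l ∘ suc) (w ∘ suc))) ⟩
  ∑[ q < suc n ] (l q * det (M [ p ]≔ w q))
    ∎
  where open ≡-Reasoning

det-row-operation : ∀ {r} (M : Matrix r) p c (l : Vector ℤ r) {v : Vector ℤ r} → l p ≡ + 0 →
  (∀ j → v j ≡ c * M p j + ∑[ q < r ] (l q * M q j)) → det (M [ p ]≔ v) ≡ c * det M
det-row-operation {r} M p c l {v} lₚ≡0 v≡ = begin
  det (M [ p ]≔ v)
    ≡⟨ det-linear-row M p c (+ 1) (λ j → trans (v≡ j) (cong (_+_ (c * M p j)) (sym (*-identityˡ (∑[ q < r ] (l q * M q j)))))) ⟩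
  c * det (M [ p ]≔ M p) + + 1 * det (M [ p ]≔ (λ j → ∑[ q < r ] (l q * M q j)))
    ≡⟨ cong₂ (λ x y → c * x + + 1 * y) (det-cong (M [ p ]≔ M p) M λ i → cong-app (updateAt-id-local p M refl i))
                                       (trans (det-row-combination M p l M) (sum-zero _ vanish)) ⟩
  c * det M + + 1 * + 0
    ≡⟨ plus-zero c (det M) ⟩
  c * det M
    ∎
  where
  open ≡-Reasoning
  vanish : ∀ q → l q * det (M [ p ]≔ M q) ≡ + 0
  vanish q with q ≟ p
  ... | yes refl = cong (_* det (M [ p ]≔ M p)) lₚ≡0
  ... | no q≢p   = trans (cong (l q *_) (det-equal-rows (M [ p ]≔ M q) p q (q≢p ∘ sym) λ j →
                           cong-app (trans (updateAt-updates p M) (sym (updateAt-minimal q p M q≢p))) j))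
                         (*-zeroʳ (l q))
  plus-zero : ∀ c d → c * d + + 1 * + 0 ≡ c * d
  plus-zero = solve-∀

det-expand-column : ∀ {r} (c : Fin (suc r)) (M : Matrix (suc r)) →
  det M ≡ alt c * ∑[ i < suc r ] (alt i * (M i c * det (minor M i c)))
det-expand-column {r} c M = begin
  det M                                                          ≡⟨ sym (det-transpose M) ⟩
  det (M ᵀ)                                                      ≡⟨ det-expand-row c (M ᵀ) ⟩
  alt c * ∑[ i < suc r ] (alt i * (M i c * det (minor M i c ᵀ))) ≡⟨ cong (alt c *_) (sum-cong-≗ λ i →
                                                                      cong (λ d → alt i * (M i c * d)) (det-transpose (minor M i c))) ⟩
  alt c * ∑[ i < suc r ] (alt i * (M i c * det (minor M i c)))   ∎
  where open ≡-Reasoning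

-- Cramer's rule

det-minor-updateAt : ∀ {r} (M : Matrix (suc r)) p v j → det (minor (M [ p ]≔ v) p j) ≡ det (minor M p j)
det-minor-updateAt M p v j = det-cong (minor (M [ p ]≔ v) p j) (minor M p j) λ a c →
  cong-app (updateAt-minimal (punchIn p a) p M (punchInᵢ≢i p a)) (punchIn j c)

det-replace-column : ∀ {r} (M : Matrix (suc r)) j c →
  ∑[ q < suc r ] (alt q * (alt j * (M q c * det (minor M q j)))) ≡ det ((M ᵀ) [ j ]≔ (λ q → M q c))
det-replace-column {r} M j c = sym (begin
  det Y
    ≡⟨ det-expand-row j Y ⟩
  alt j * ∑[ q < suc r ] (alt q * (Y j q * det (minor Y j q)))
    ≡⟨ cong (alt j *_) (sum-cong-≗ λ q → cong₂ (λ x d → alt q * (x * d))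
         (cong-app (updateAt-updates j {f = const (λ q → M q c)} (M ᵀ)) q)
         (trans (det-minor-updateAt (M ᵀ) j (λ q → M q c) q) (det-transpose (minor M q j)))) ⟩
  alt j * ∑[ q < suc r ] (alt q * (M q c * det (minor M q j)))
    ≡⟨ *-distribˡ-sum (alt j) (λ q → alt q * (M q c * det (minor M q j))) ⟩
  ∑[ q < suc r ] (alt j * (alt q * (M q c * det (minor M q j))))
    ≡⟨ sum-cong-≗ (λ q → swap-signs (alt j) (alt q) (M q c * det (minor M q j))) ⟩
  ∑[ q < suc r ] (alt q * (alt j * (M q c * det (minor M q j))))
    ∎)
  where
  open ≡-Reasoning
  Y : Matrix (suc r)
  Y = (M ᵀ) [ j ]≔ (λ q → M q c)
  swap-signs : ∀ a b x → a * (b * x) ≡ b * (a * x)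
  swap-signs = solve-∀

det-replace-column-self : ∀ {r} (M : Matrix r) c → det ((M ᵀ) [ c ]≔ (λ q → M q c)) ≡ det M
det-replace-column-self M c =
  trans (det-cong ((M ᵀ) [ c ]≔ (λ q → M q c)) (M ᵀ) λ i → cong-app (updateAt-id-local c (M ᵀ) refl i)) (det-transpose M)

det-replace-column-other : ∀ {r} (M : Matrix r) j c → j ≢ c → det ((M ᵀ) [ j ]≔ (λ q → M q c)) ≡ + 0
det-replace-column-other M j c j≢c = det-equal-rows ((M ᵀ) [ j ]≔ (λ q → M q c)) j c j≢c λ q →
  cong-app (trans (updateAt-updates j (M ᵀ)) (sym (updateAt-minimal c j (M ᵀ) (j≢c ∘ sym)))) q

cramer : ∀ {r} (M : Matrix r) (y : Vector ℤ r) c → ∑[ q < r ] (det (M [ q ]≔ y) * M q c) ≡ det M * y c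
cramer {suc r} M y c = begin
  ∑[ q < suc r ] (det (M [ q ]≔ y) * M q c)              ≡⟨ sum-cong-≗ expand ⟩
  ∑[ q < suc r ] ∑[ j < suc r ] (y j * C q j)             ≡⟨ ∑-comm (λ q j → y j * C q j) ⟩
  ∑[ j < suc r ] ∑[ q < suc r ] (y j * C q j)             ≡⟨ sum-cong-≗ (λ j → sym (*-distribˡ-sum (y j) (λ q → C q j))) ⟩
  ∑[ j < suc r ] (y j * ∑[ q < suc r ] C q j)             ≡⟨ sum-cong-≗ (λ j → cong (y j *_) (det-replace-column M j c)) ⟩
  ∑[ j < suc r ] (y j * det ((M ᵀ) [ j ]≔ (λ q → M q c))) ≡⟨ sum-single _ c (λ j j≢c →
                                                              trans (cong (y j *_) (det-replace-column-other M j c j≢c)) (*-zeroʳ (y j))) ⟩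
  y c * det ((M ᵀ) [ c ]≔ (λ q → M q c))                  ≡⟨ cong (y c *_) (det-replace-column-self M c) ⟩
  y c * det M                                            ≡⟨ *-comm (y c) (det M) ⟩
  det M * y c                                            ∎
  where
  open ≡-Reasoning
  C : Fin (suc r) → Fin (suc r) → ℤ
  C q j = alt q * (alt j * (M q c * det (minor M q j)))
  expand : ∀ q → det (M [ q ]≔ y) * M q c ≡ ∑[ j < suc r ] (y j * C q j)
  expand q = begin
    det (M [ q ]≔ y) * M q c
      ≡⟨ cong (_* M q c) (det-expand-row q (M [ q ]≔ y)) ⟩
    alt q * ∑[ j < suc r ] (alt j * ((M [ q ]≔ y) q j * det (minor (M [ q ]≔ y) q j))) * M q c
      ≡⟨ cong (λ S → alt q * S * M q c) (sum-cong-≗ λ j → cong₂ (λ x d → alt j * (x * d))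
           (cong-app (updateAt-updates q {f = const y} M) j) (det-minor-updateAt M q y j)) ⟩
    alt q * ∑[ j < suc r ] (alt j * (y j * det (minor M q j))) * M q c
      ≡⟨ move-right (alt q) _ (M q c) ⟩
    alt q * M q c * ∑[ j < suc r ] (alt j * (y j * det (minor M q j)))
      ≡⟨ *-distribˡ-sum (alt q * M q c) (λ j → alt j * (y j * det (minor M q j))) ⟩
    ∑[ j < suc r ] (alt q * M q c * (alt j * (y j * det (minor M q j))))
      ≡⟨ sum-cong-≗ (λ j → regroup (alt q) (M q c) (alt j) (y j) (det (minor M q j))) ⟩
    ∑[ j < suc r ] (y j * C q j)
      ∎
    where
    move-right : ∀ a S m → a * S * m ≡ a * m * S
    move-right = solve-∀
    regroup : ∀ a m b x d → a * m * (b * (x * d)) ≡ x * (a * (b * (m * d)))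
    regroup = solve-∀

-- Unimodularity of incidence matrices

IsUnit : ℤ → Set
IsUnit x = x ≡ + 1 ⊎ x ≡ - + 1

+1≢-1 : + 1 ≢ - + 1
+1≢-1 ()

IsUnit-* : ∀ {x y} → IsUnit x → IsUnit y → IsUnit (x * y)
IsUnit-* (inj₁ refl) (inj₁ refl) = inj₁ refl
IsUnit-* (inj₁ refl) (inj₂ refl) = inj₂ refl
IsUnit-* (inj₂ refl) (inj₁ refl) = inj₂ refl
IsUnit-* (inj₂ refl) (inj₂ refl) = inj₁ refl

IsUnit-negOnePow : ∀ n → IsUnit (negOnePow n)
IsUnit-negOnePow zero    = inj₁ refl
IsUnit-negOnePow (suc n) with IsUnit-negOnePow n
... | inj₁ eq = inj₂ (cong -_ eq)
... | inj₂ eq = inj₁ (cong -_ eq)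

IsUnit⇒square≡1 : ∀ {x} → IsUnit x → x * x ≡ + 1
IsUnit⇒square≡1 (inj₁ refl) = refl
IsUnit⇒square≡1 (inj₂ refl) = refl

IsIncidenceColumn : ∀ {r} → Vector ℤ r → Set
IsIncidenceColumn {r} v =
    (∀ i → v i ≡ + 0)
  ⊎ (Σ[ i ∈ Fin r ] (IsUnit (v i) × (∀ i′ → i′ ≢ i → v i′ ≡ + 0)))
  ⊎ (Σ[ i ∈ Fin r ] Σ[ i′ ∈ Fin r ] (v i ≡ + 1 × v i′ ≡ - + 1 × (∀ i″ → i″ ≢ i → i″ ≢ i′ → v i″ ≡ + 0)))

IsIncidenceColumn-cong : ∀ {r} {v w : Vector ℤ r} → v ≗ w → IsIncidenceColumn v → IsIncidenceColumn w
IsIncidenceColumn-cong v≗w (inj₁ v≡0) = inj₁ λ i → trans (sym (v≗w i)) (v≡0 i)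
IsIncidenceColumn-cong v≗w (inj₂ (inj₁ (i , unit , v≡0))) =
  inj₂ (inj₁ (i , subst IsUnit (v≗w i) unit , λ i′ i′≢i → trans (sym (v≗w i′)) (v≡0 i′ i′≢i)))
IsIncidenceColumn-cong v≗w (inj₂ (inj₂ (i , i′ , vᵢ≡1 , vᵢ′≡-1 , v≡0))) =
  inj₂ (inj₂ (i , i′ , trans (sym (v≗w i)) vᵢ≡1 , trans (sym (v≗w i′)) vᵢ′≡-1 ,
              λ i″ i″≢i i″≢i′ → trans (sym (v≗w i″)) (v≡0 i″ i″≢i i″≢i′)))

IsIncidenceColumn-removeAt : ∀ {r} (v : Vector ℤ (suc r)) p → IsIncidenceColumn v → IsIncidenceColumn (v ∘ punchIn p)
IsIncidenceColumn-removeAt v p (inj₁ v≡0) = inj₁ (v≡0 ∘ punchIn p)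
IsIncidenceColumn-removeAt v p (inj₂ (inj₁ (i , unit , v≡0))) with i ≟ p
... | yes refl = inj₁ λ a → v≡0 (punchIn p a) (punchInᵢ≢i p a)
... | no i≢p with punchIn-preimage p i i≢p
...   | a , punchIn-a = inj₂ (inj₁ (a , subst (IsUnit ∘ v) (sym punchIn-a) unit ,
                                        λ b b≢a → v≡0 (punchIn p b) (punchIn-≢ p punchIn-a b≢a)))
IsIncidenceColumn-removeAt v p (inj₂ (inj₂ (i , i′ , vᵢ≡1 , vᵢ′≡-1 , v≡0))) with i ≟ p | i′ ≟ p
... | yes refl | yes refl = ⊥-elim (+1≢-1 (trans (sym vᵢ≡1) vᵢ′≡-1))
... | yes refl | no i′≢p with punchIn-preimage p i′ i′≢p
...   | a′ , punchIn-a′ = inj₂ (inj₁ (a′ , inj₂ (trans (cong v punchIn-a′) vᵢ′≡-1) ,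
                                        λ b b≢a′ → v≡0 (punchIn p b) (punchInᵢ≢i p b) (punchIn-≢ p punchIn-a′ b≢a′)))
IsIncidenceColumn-removeAt v p (inj₂ (inj₂ (i , i′ , vᵢ≡1 , vᵢ′≡-1 , v≡0))) | no i≢p | yes refl
  with punchIn-preimage p i i≢p
... | a , punchIn-a = inj₂ (inj₁ (a , inj₁ (trans (cong v punchIn-a) vᵢ≡1) ,
                                      λ b b≢a → v≡0 (punchIn p b) (punchIn-≢ p punchIn-a b≢a) (punchInᵢ≢i p b)))
IsIncidenceColumn-removeAt v p (inj₂ (inj₂ (i , i′ , vᵢ≡1 , vᵢ′≡-1 , v≡0))) | no i≢p | no i′≢p
  with punchIn-preimage p i i≢p | punchIn-preimage p i′ i′≢p
... | a , punchIn-a | a′ , punchIn-a′ =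
  inj₂ (inj₂ (a , a′ , trans (cong v punchIn-a) vᵢ≡1 , trans (cong v punchIn-a′) vᵢ′≡-1 ,
              λ b b≢a b≢a′ → v≡0 (punchIn p b) (punchIn-≢ p punchIn-a b≢a) (punchIn-≢ p punchIn-a′ b≢a′)))

some-or-all : ∀ {n} {P Q : Fin n → Set} → (∀ i → P i ⊎ Q i) → ∃ P ⊎ (∀ i → Q i)
some-or-all {zero}  P⊎Q = inj₂ λ ()
some-or-all {suc n} P⊎Q with P⊎Q zero | some-or-all (P⊎Q ∘ suc)
... | inj₁ P₀ | _             = inj₁ (zero , P₀)
... | inj₂ Q₀ | inj₁ (i , Pᵢ) = inj₁ (suc i , Pᵢ)
... | inj₂ Q₀ | inj₂ Q        = inj₂ λ { zero → Q₀ ; (suc i) → Q i }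

det-columns-sum-zero : ∀ {r} (M : Matrix (suc r)) → (∀ c → ∑[ i < suc r ] M i c ≡ + 0) → det M ≡ + 0
det-columns-sum-zero {r} M sum≡0 = begin
  det M                         ≡⟨ sym (*-identityˡ (det M)) ⟩
  + 1 * det M                   ≡⟨ sym (det-row-operation M zero (+ 1) l refl 0≡) ⟩
  det (M [ zero ]≔ (λ _ → + 0)) ≡⟨ det-zero-row (M [ zero ]≔ (λ _ → + 0)) zero (λ _ → refl) ⟩
  + 0                           ∎
  where
  open ≡-Reasoning
  l : Vector ℤ (suc r)
  l zero    = + 0
  l (suc _) = + 1
  0≡ : ∀ j → + 0 ≡ + 1 * M zero j + ∑[ q < suc r ] (l q * M q j)
  0≡ j = sym (begin
    + 1 * M zero j + (+ 0 * M zero j + ∑[ a < r ] (+ 1 * M (suc a) j))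
      ≡⟨ cong (λ S → + 1 * M zero j + (+ 0 * M zero j + S)) (sum-cong-≗ λ a → *-identityˡ (M (suc a) j)) ⟩
    + 1 * M zero j + (+ 0 * M zero j + ∑[ a < r ] M (suc a) j)
      ≡⟨ simplify (M zero j) _ ⟩
    ∑[ i < suc r ] M i j
      ≡⟨ sum≡0 j ⟩
    + 0
      ∎)
    where
    simplify : ∀ x S → + 1 * x + (+ 0 * x + S) ≡ x + S
    simplify = solve-∀

det-incidence-unimodular : ∀ {r} (M : Matrix r) → (∀ c → IsIncidenceColumn (λ i → M i c)) → det M ≡ + 0 ⊎ IsUnit (det M)
det-incidence-unimodular {zero}  M columns = inj₂ (inj₁ refl)
det-incidence-unimodular {suc r} M columns with some-or-all (assocˡ ∘ columns)
... | inj₁ (c , inj₁ column≡0) = inj₁ (trans (sym (det-transpose M)) (det-zero-row (M ᵀ) c column≡0))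
... | inj₁ (c , inj₂ (i , unit , column≡0)) =
  subst (λ d → d ≡ + 0 ⊎ IsUnit d) (sym expansion) (scale (det-incidence-unimodular (minor M i c) minor-columns))
  where
  expansion : det M ≡ alt c * (alt i * (M i c * det (minor M i c)))
  expansion = trans (det-expand-column c M) (cong (alt c *_) (sum-single _ i λ i′ i′≢i →
    trans (cong (λ x → alt i′ * (x * det (minor M i′ c))) (column≡0 i′ i′≢i)) (*-zeroʳ (alt i′))))
  minor-columns : ∀ c′ → IsIncidenceColumn (λ a → minor M i c a c′)
  minor-columns c′ = IsIncidenceColumn-removeAt (λ a → M a (punchIn c c′)) i (columns (punchIn c c′))
  scale : ∀ {d} → d ≡ + 0 ⊎ IsUnit d → alt c * (alt i * (M i c * d)) ≡ + 0 ⊎ IsUnit (alt c * (alt i * (M i c * d)))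
  scale (inj₁ refl)  = inj₁ (cofactor-term-zero (alt c) (alt i) (*-zeroʳ (M i c)))
  scale (inj₂ unit′) = inj₂ (IsUnit-* (IsUnit-negOnePow (toℕ c)) (IsUnit-* (IsUnit-negOnePow (toℕ i)) (IsUnit-* unit unit′)))
... | inj₂ pairs = inj₁ (det-columns-sum-zero M pair-sum)
  where
  pair-sum : ∀ c → ∑[ i < suc r ] M i c ≡ + 0
  pair-sum c with pairs c
  ... | i , i′ , Mᵢ≡1 , Mᵢ′≡-1 , M≡0 =
    trans (sum-pair _ i i′ (λ { refl → +1≢-1 (trans (sym Mᵢ≡1) Mᵢ′≡-1) }) M≡0) (cong₂ _+_ Mᵢ≡1 Mᵢ′≡-1)

-- The sign of a permutation

inverted : ∀ {k} → (Fin k → Fin k) → Fin k → Fin k → ℕ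
inverted f i j = if (toℕ i <ᵇ toℕ j) ∧ (toℕ (f j) <ᵇ toℕ (f i)) then 1 else 0

inversions≡∑ : ∀ {k} (f : Fin k → Fin k) → inversions f ≡ ℕ∑.sum (λ i → ℕ∑.sum (inverted f i))
inversions≡∑ {k} f = trans (foldr-map-tabulate ℕ._+_ 0 (λ i → ℕ.sum (map (inverted f i) (allFin k))) id)
                           (ℕ∑.sum-cong-≗ λ i → foldr-map-tabulate ℕ._+_ 0 (inverted f i) id)

punchIn-<ᵇ : ∀ {n} (p : Fin (suc n)) x y → (toℕ (punchIn p x) <ᵇ toℕ (punchIn p y)) ≡ (toℕ x <ᵇ toℕ y)
punchIn-<ᵇ zero    x       y       = refl
punchIn-<ᵇ (suc p) zero    zero    = refl
punchIn-<ᵇ (suc p) zero    (suc y) = refl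
punchIn-<ᵇ (suc p) (suc x) zero    = refl
punchIn-<ᵇ (suc p) (suc x) (suc y) = punchIn-<ᵇ p x y

punchIn-<ᵇ-pivot : ∀ {n} (p : Fin (suc n)) x → (toℕ (punchIn p x) <ᵇ toℕ p) ≡ (toℕ x <ᵇ toℕ p)
punchIn-<ᵇ-pivot zero    x       = refl
punchIn-<ᵇ-pivot (suc p) zero    = refl
punchIn-<ᵇ-pivot (suc p) (suc x) = punchIn-<ᵇ-pivot p x

count-below : ∀ n t → t ℕ.≤ n → ℕ∑.sum (λ (y : Fin n) → if toℕ y <ᵇ t then 1 else 0) ≡ t
count-below zero    zero    _           = refl
count-below (suc n) zero    _           = ℕ∑.sum-replicate-zero n
count-below (suc n) (suc t) (ℕ.s≤s t≤n) = cong suc (count-below n t t≤n)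

-- The pairs (0, j) contribute one inversion for each value below σ 0; the other pairs are
-- exactly the inversions of remove 0 σ, because punchIn (σ 0) preserves order.
inversions-remove : ∀ {k} (σ : Permutation′ (suc k)) →
  inversions (σ ⟨$⟩ʳ_) ≡ toℕ (σ ⟨$⟩ʳ zero) ℕ.+ inversions (remove zero σ ⟨$⟩ʳ_)
inversions-remove {k} σ = begin
  inversions f
    ≡⟨ inversions≡∑ f ⟩
  ℕ∑.sum (inverted f zero) ℕ.+ ℕ∑.sum (λ a → ℕ∑.sum (inverted f (suc a)))
    ≡⟨ cong₂ ℕ._+_ first-row other-rows ⟩
  toℕ p ℕ.+ ℕ∑.sum (λ a → ℕ∑.sum (inverted f′ a))
    ≡⟨ cong (toℕ p ℕ.+_) (sym (inversions≡∑ f′)) ⟩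
  toℕ p ℕ.+ inversions f′
    ∎
  where
  open ≡-Reasoning
  f : Fin (suc k) → Fin (suc k)
  f = σ ⟨$⟩ʳ_
  f′ : Fin k → Fin k
  f′ = remove zero σ ⟨$⟩ʳ_
  p : Fin (suc k)
  p = f zero
  f-suc : ∀ c → f (suc c) ≡ punchIn p (f′ c)
  f-suc = punchIn-permute σ zero
  below : Fin k → ℕ
  below y = if toℕ y <ᵇ toℕ p then 1 else 0
  first-row : ℕ∑.sum (inverted f zero) ≡ toℕ p
  first-row = begin
    ℕ∑.sum (λ c → if toℕ (f (suc c)) <ᵇ toℕ p then 1 else 0)
      ≡⟨ ℕ∑.sum-cong-≗ (λ c → cong (λ b → if b then 1 else 0)
           (trans (cong (λ x → toℕ x <ᵇ toℕ p) (f-suc c)) (punchIn-<ᵇ-pivot p (f′ c)))) ⟩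
    ℕ∑.sum (below ∘ f′)
      ≡⟨ sym (ℕ∑.sum-permute below (remove zero σ)) ⟩
    ℕ∑.sum below
      ≡⟨ count-below k (toℕ p) (toℕ≤pred[n] p) ⟩
    toℕ p
      ∎
  other-rows : ℕ∑.sum (λ a → ℕ∑.sum (inverted f (suc a))) ≡ ℕ∑.sum (λ a → ℕ∑.sum (inverted f′ a))
  other-rows = ℕ∑.sum-cong-≗ λ a → ℕ∑.sum-cong-≗ λ c → cong (λ b → if (toℕ a <ᵇ toℕ c) ∧ b then 1 else 0)
    (trans (cong₂ (λ x y → toℕ x <ᵇ toℕ y) (f-suc c) (f-suc a)) (punchIn-<ᵇ p (f′ c) (f′ a)))

negOnePow-+ : ∀ m n → negOnePow (m ℕ.+ n) ≡ negOnePow m * negOnePow n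
negOnePow-+ zero    n = sym (*-identityˡ (negOnePow n))
negOnePow-+ (suc m) n = trans (cong -_ (negOnePow-+ m n)) (neg-distribˡ-* (negOnePow m) (negOnePow n))

negOnePow≡-1^ : ∀ n → negOnePow n ≡ (- + 1) ^ n
negOnePow≡-1^ zero    = refl
negOnePow≡-1^ (suc n) = trans (cong -_ (negOnePow≡-1^ n)) (negate ((- + 1) ^ n))
  where
  negate : ∀ x → - x ≡ - + 1 * x
  negate = solve-∀

sgnPerm-remove : ∀ {k} (σ : Permutation′ (suc k)) → sgnPerm σ ≡ alt (σ ⟨$⟩ʳ zero) * sgnPerm (remove zero σ)
sgnPerm-remove σ = trans (cong negOnePow (inversions-remove σ)) (negOnePow-+ (toℕ (σ ⟨$⟩ʳ zero)) _)

-- Block matrices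

++-suc : ∀ {A : Set} {k m} (xs : Vector A (suc k)) (ys : Vector A m) i → (xs ++ ys) (suc i) ≡ (Vec.tail xs ++ ys) i
++-suc {k = k} xs ys i = [,]-map (splitAt k i)

++-punchIn-↑ˡ : ∀ {A : Set} {k m} (xs : Vector A (suc k)) (ys : Vector A m) p a →
  (xs ++ ys) (punchIn (p ↑ˡ m) a) ≡ (removeAt xs p ++ ys) a
++-punchIn-↑ˡ             xs ys zero    a       = ++-suc xs ys a
++-punchIn-↑ˡ {k = suc k} xs ys (suc p) zero    = refl
++-punchIn-↑ˡ {k = suc k} xs ys (suc p) (suc a) =
  trans (++-suc xs ys (punchIn (p ↑ˡ _) a)) (trans (++-punchIn-↑ˡ (Vec.tail xs) ys p a) (sym (++-suc (removeAt xs (suc p)) ys a)))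

++-injective : ∀ {A : Set} {k m} (xs : Vector A k) (ys : Vector A m) → Injective _≡_ _≡_ xs → Injective _≡_ _≡_ ys →
  (∀ a x → xs a ≢ ys x) → Injective _≡_ _≡_ (xs ++ ys)
++-injective {k = k} {m} xs ys xs-inj ys-inj disjoint {i} {j} eq =
  trans (sym (join-splitAt k m i)) (trans (cong (join k m) (split-inj (splitAt k i) (splitAt k j) eq)) (join-splitAt k m j))
  where
  split-inj : ∀ s s′ → [ xs , ys ] s ≡ [ xs , ys ] s′ → s ≡ s′
  split-inj (inj₁ a) (inj₁ a′) e = cong inj₁ (xs-inj e)
  split-inj (inj₁ a) (inj₂ x′) e = ⊥-elim (disjoint a x′ e)
  split-inj (inj₂ x) (inj₁ a′) e = ⊥-elim (disjoint a′ x (sym e))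
  split-inj (inj₂ x) (inj₂ x′) e = cong inj₂ (ys-inj e)

minor-++ : ∀ {k m} (G : Vector (Vector ℤ (suc k ℕ.+ m)) (suc k)) (U : Vector (Vector ℤ (suc k ℕ.+ m)) m) p j a c →
  minor (G ++ U) (p ↑ˡ m) j a c ≡ ((λ b → G (punchIn p b) ∘ punchIn j) ++ (λ x → U x ∘ punchIn j)) a c
minor-++ {k} G U p j a c =
  trans (cong (λ row → row (punchIn j c)) (++-punchIn-↑ˡ G U p a)) (cong-app ([,]-∘ (_∘ punchIn j) (splitAt k a)) c)

det-permute-block : ∀ {k m} (σ : Permutation′ k) (G : Vector (Vector ℤ (k ℕ.+ m)) k) (U : Vector (Vector ℤ (k ℕ.+ m)) m) →
  det ((G ∘ (σ ⟨$⟩ʳ_)) ++ U) ≡ sgnPerm σ * det (G ++ U)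
det-permute-block {zero}      σ G U = sym (*-identityˡ (det (G ++ U)))
det-permute-block {suc k} {m} σ G U = sym (begin
  sgnPerm σ * det (G ++ U)
    ≡⟨ cong₂ _*_ (sgnPerm-remove σ) (det-expand-row (p ↑ˡ m) (G ++ U)) ⟩
  alt p * s′ * (alt (p ↑ˡ m) * ∑[ j < suc (k ℕ.+ m) ] (alt j * ((G ++ U) (p ↑ˡ m) j * D j)))
    ≡⟨ cong₂ (λ a S → alt p * s′ * (a * S)) (cong negOnePow (toℕ-↑ˡ p m))
             (sum-cong-≗ λ j → cong (λ x → alt j * (x * D j)) (cong-app (lookup-++ˡ G U p) j)) ⟩
  alt p * s′ * (alt p * ∑[ j < suc (k ℕ.+ m) ] (alt j * (G p j * D j)))
    ≡⟨ cancel-sign (alt p) s′ _ (IsUnit⇒square≡1 (IsUnit-negOnePow (toℕ p))) ⟩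
  s′ * ∑[ j < suc (k ℕ.+ m) ] (alt j * (G p j * D j))
    ≡⟨ *-distribˡ-sum s′ (λ j → alt j * (G p j * D j)) ⟩
  ∑[ j < suc (k ℕ.+ m) ] (s′ * (alt j * (G p j * D j)))
    ≡⟨ sum-cong-≗ (λ j → trans (regroup s′ (alt j) (G p j) (D j)) (cong (λ d → alt j * (G p j * d)) (sym (permuted-minor j)))) ⟩
  ∑[ j < suc (k ℕ.+ m) ] (alt j * (G p j * det (minor ((G ∘ (σ ⟨$⟩ʳ_)) ++ U) zero j)))
    ≡⟨ sym (det-expand-row₀ ((G ∘ (σ ⟨$⟩ʳ_)) ++ U)) ⟩
  det ((G ∘ (σ ⟨$⟩ʳ_)) ++ U)
    ∎)
  where
  open ≡-Reasoning
  p : Fin (suc k)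
  p = σ ⟨$⟩ʳ zero
  σ′ : Permutation′ k
  σ′ = remove zero σ
  s′ : ℤ
  s′ = sgnPerm σ′
  D : Fin (suc (k ℕ.+ m)) → ℤ
  D j = det (minor (G ++ U) (p ↑ˡ m) j)
  permuted-minor : ∀ j → det (minor ((G ∘ (σ ⟨$⟩ʳ_)) ++ U) zero j) ≡ s′ * D j
  permuted-minor j = begin
    det (minor ((G ∘ (σ ⟨$⟩ʳ_)) ++ U) zero j)
      ≡⟨ det-cong _ ((G′ ∘ (σ′ ⟨$⟩ʳ_)) ++ U′) (λ a c → trans (minor-++ (G ∘ (σ ⟨$⟩ʳ_)) U zero j a c)
           (cong-app (++-cong _ (G′ ∘ (σ′ ⟨$⟩ʳ_)) (λ b → cong (λ i → G i ∘ punchIn j) (punchIn-permute σ zero b))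
                                                (λ _ → refl) a) c)) ⟩
    det ((G′ ∘ (σ′ ⟨$⟩ʳ_)) ++ U′)
      ≡⟨ det-permute-block σ′ G′ U′ ⟩
    s′ * det (G′ ++ U′)
      ≡⟨ cong (s′ *_) (det-cong (G′ ++ U′) _ λ a c → sym (minor-++ G U p j a c)) ⟩
    s′ * D j
      ∎
    where
    G′ : Vector (Vector ℤ (k ℕ.+ m)) k
    G′ b = G (punchIn p b) ∘ punchIn j
    U′ : Vector (Vector ℤ (k ℕ.+ m)) m
    U′ x = U x ∘ punchIn j
  cancel-sign : ∀ a s S → a * a ≡ + 1 → a * s * (a * S) ≡ s * S
  cancel-sign a s S a²≡1 = trans (regroup′ a s S) (trans (cong (_* (s * S)) a²≡1) (*-identityˡ (s * S)))
    where
    regroup′ : ∀ a s S → a * s * (a * S) ≡ a * a * (s * S)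
    regroup′ = solve-∀
  regroup : ∀ s a x d → s * (a * (x * d)) ≡ a * (x * (s * d))
  regroup = solve-∀

det-replace-block : ∀ {k m} c (G H : Vector (Vector ℤ (k ℕ.+ m)) k) (U : Vector (Vector ℤ (k ℕ.+ m)) m)
  (l : Fin k → Fin m → ℤ) → (∀ a j → G a j ≡ c * H a j + ∑[ x < m ] (l a x * U x j)) → det (G ++ U) ≡ c ^ k * det (H ++ U)
det-replace-block {zero}      c G H U l G≡ = sym (*-identityˡ (det (H ++ U)))
det-replace-block {suc k} {m} c G H U l G≡ = begin
  det (G ++ U)
    ≡⟨ det-expand-row₀ (G ++ U) ⟩
  ∑[ j < suc (k ℕ.+ m) ] (alt j * (G zero j * det (minor (G ++ U) zero j)))
    ≡⟨ sum-cong-≗ (λ j → trans (cong (λ d → alt j * (G zero j * d)) (replaced-minor j))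
                               (regroup (c ^ k) (alt j) (G zero j) (D j))) ⟩
  ∑[ j < suc (k ℕ.+ m) ] (c ^ k * (alt j * (G zero j * D j)))
    ≡⟨ sym (*-distribˡ-sum (c ^ k) (λ j → alt j * (G zero j * D j))) ⟩
  c ^ k * ∑[ j < suc (k ℕ.+ m) ] (alt j * (G zero j * D j))
    ≡⟨ cong (c ^ k *_) (sym (det-expand-row₀ ((H ++ U) [ zero ]≔ G zero))) ⟩
  c ^ k * det ((H ++ U) [ zero ]≔ G zero)
    ≡⟨ cong (c ^ k *_) (det-row-operation (H ++ U) zero c l′ refl first-row) ⟩
  c ^ k * (c * det (H ++ U))
    ≡⟨ shuffle (c ^ k) c (det (H ++ U)) ⟩
  c ^ suc k * det (H ++ U)
    ∎
  where
  open ≡-Reasoning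
  D : Fin (suc (k ℕ.+ m)) → ℤ
  D j = det (minor (H ++ U) zero j)
  replaced-minor : ∀ j → det (minor (G ++ U) zero j) ≡ c ^ k * D j
  replaced-minor j = begin
    det (minor (G ++ U) zero j) ≡⟨ det-cong _ (G′ ++ U′) (minor-++ G U zero j) ⟩
    det (G′ ++ U′)              ≡⟨ det-replace-block c G′ H′ U′ (l ∘ suc) (λ a i → G≡ (suc a) (punchIn j i)) ⟩
    c ^ k * det (H′ ++ U′)      ≡⟨ cong (c ^ k *_) (det-cong (H′ ++ U′) _ λ a i → sym (minor-++ H U zero j a i)) ⟩
    c ^ k * D j                 ∎
    where
    G′ H′ : Vector (Vector ℤ (k ℕ.+ m)) k
    G′ b = G (suc b) ∘ punchIn j
    H′ b = H (suc b) ∘ punchIn j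
    U′ : Vector (Vector ℤ (k ℕ.+ m)) m
    U′ x = U x ∘ punchIn j
  zeros : Vector ℤ (suc k)
  zeros _ = + 0
  l′ : Vector ℤ (suc k ℕ.+ m)
  l′ = zeros ++ l zero
  first-row : ∀ j → G zero j ≡ c * H zero j + ∑[ q < suc k ℕ.+ m ] (l′ q * (H ++ U) q j)
  first-row j = trans (G≡ zero j) (cong (_+_ (c * H zero j)) (sym (begin
    ∑[ q < suc k ℕ.+ m ] (l′ q * (H ++ U) q j)
      ≡⟨ sum-split {suc k} {m} (λ q → l′ q * (H ++ U) q j) ⟩
    ∑[ a < suc k ] (l′ (a ↑ˡ m) * (H ++ U) (a ↑ˡ m) j) + ∑[ x < m ] (l′ (suc k ↑ʳ x) * (H ++ U) (suc k ↑ʳ x) j)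
      ≡⟨ cong₂ _+_ (sum-zero _ λ a → cong (_* (H ++ U) (a ↑ˡ m) j) (lookup-++ˡ zeros (l zero) a))
                   (sum-cong-≗ λ x → cong₂ (λ y row → y * row j) (lookup-++ʳ zeros (l zero) x) (lookup-++ʳ H U x)) ⟩
    + 0 + ∑[ x < m ] (l zero x * U x j)
      ≡⟨ +-identityˡ (∑[ x < m ] (l zero x * U x j)) ⟩
    ∑[ x < m ] (l zero x * U x j)
      ∎)))
  regroup : ∀ e a x d → a * (x * (e * d)) ≡ e * (a * (x * d))
  regroup = solve-∀
  shuffle : ∀ e c d → e * (c * d) ≡ c * e * d
  shuffle = solve-∀

-- Incidence matrices of G* and disjoint S–T paths

δ : ∀ {n} → Fin n → Fin n → ℤ
δ x y = if does (x ≟ y) then + 1 else + 0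

δ-refl : ∀ {n} (x : Fin n) → δ x x ≡ + 1
δ-refl x = cong (λ b → if b then + 1 else + 0) (dec-true (x ≟ x) refl)

δ-≢ : ∀ {n} {x y : Fin n} → x ≢ y → δ x y ≡ + 0
δ-≢ {x = x} {y} x≢y = cong (λ b → if b then + 1 else + 0) (dec-false (x ≟ y) x≢y)

IsIncidenceColumn-δ : ∀ {r n} (ρ : Fin r → Fin n) → Injective _≡_ _≡_ ρ → ∀ x {ε} → IsUnit ε →
  IsIncidenceColumn (λ i → δ (ρ i) x * ε)
IsIncidenceColumn-δ ρ ρ-inj x {ε} unit with any? (λ i → ρ i ≟ x)
... | yes (i , refl) = inj₂ (inj₁ (i , subst IsUnit (sym (trans (cong (_* ε) (δ-refl (ρ i))) (*-identityˡ ε))) unit ,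
                                   λ i′ i′≢i → cong (_* ε) (δ-≢ (i′≢i ∘ ρ-inj))))
... | no ∄i          = inj₁ λ i → cong (_* ε) (δ-≢ λ ρᵢ≡x → ∄i (i , ρᵢ≡x))

IsIncidenceColumn-δ-difference : ∀ {r n} (ρ : Fin r → Fin n) → Injective _≡_ _≡_ ρ → ∀ {x y} → x ≢ y →
  IsIncidenceColumn (λ i → δ (ρ i) x - δ (ρ i) y)
IsIncidenceColumn-δ-difference ρ ρ-inj {x} {y} x≢y with any? (λ i → ρ i ≟ x) | any? (λ i → ρ i ≟ y)
... | yes (i , refl) | yes (i′ , refl) = inj₂ (inj₂ (i , i′ ,
        cong₂ _-_ (δ-refl (ρ i)) (δ-≢ x≢y) , cong₂ _-_ (δ-≢ (x≢y ∘ sym)) (δ-refl (ρ i′)) ,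
        λ i″ i″≢i i″≢i′ → cong₂ _-_ (δ-≢ (i″≢i ∘ ρ-inj)) (δ-≢ (i″≢i′ ∘ ρ-inj))))
... | yes (i , refl) | no ∄i′ = inj₂ (inj₁ (i , inj₁ (cong₂ _-_ (δ-refl (ρ i)) (δ-≢ λ e → ∄i′ (i , e))) ,
        λ i″ i″≢i → cong₂ _-_ (δ-≢ (i″≢i ∘ ρ-inj)) (δ-≢ λ e → ∄i′ (i″ , e))))
... | no ∄i | yes (i′ , refl) = inj₂ (inj₁ (i′ , inj₂ (cong₂ _-_ (δ-≢ λ e → ∄i (i′ , e)) (δ-refl (ρ i′))) ,
        λ i″ i″≢i′ → cong₂ _-_ (δ-≢ λ e → ∄i (i″ , e)) (δ-≢ (i″≢i′ ∘ ρ-inj))))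
... | no ∄i | no ∄i′ = inj₁ λ i → cong₂ _-_ (δ-≢ λ e → ∄i (i , e)) (δ-≢ λ e → ∄i′ (i , e))

walk-potential : ∀ {A : Set} (φ : A → ℤ) L (w : Fin (suc L) → A) → (∀ a → φ (w (inject₁ a)) ≡ φ (w (suc a))) →
  φ (w zero) ≡ φ (w (fromℕ L))
walk-potential φ zero    w steps = refl
walk-potential φ (suc L) w steps = trans (steps zero) (walk-potential φ L (w ∘ suc) (steps ∘ suc))

unit-cancel : ∀ {d y z w} → d * d ≡ + 1 → d * y ≡ - d * z + w → y ≡ - + 1 * z + d * w
unit-cancel {d} {y} {z} {w} d²≡1 dy≡ = begin
  y                     ≡⟨ sym (*-identityˡ y) ⟩
  + 1 * y               ≡⟨ cong (_* y) (sym d²≡1) ⟩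
  d * d * y             ≡⟨ *-assoc d d y ⟩
  d * (d * y)           ≡⟨ cong (d *_) dy≡ ⟩
  d * (- d * z + w)     ≡⟨ expand d z w ⟩
  - (d * d) * z + d * w ≡⟨ cong (λ e → - e * z + d * w) d²≡1 ⟩
  - + 1 * z + d * w     ∎
  where
  open ≡-Reasoning
  expand : ∀ d z w → d * (- d * z + w) ≡ - (d * d) * z + d * w
  expand = solve-∀

module _ (𝒮 : Setting) where
  open Setting 𝒮

  orientation : Fin m → ℤ
  orientation x = if dir x then + 1 else - + 1

  orientation-unit : ∀ x → IsUnit (orientation x)
  orientation-unit x with dir x
  ... | true  = inj₁ refl
  ... | false = inj₂ refl

  inc-edge : ∀ w l → inc 𝒮 w (inj₁ l) ≡ δ w (tail l) - δ w (head l)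
  inc-edge w l with w ≟ tail l | w ≟ head l
  ... | yes refl | yes w≡head = ⊥-elim (loopless l w≡head)
  ... | yes _    | no _       = refl
  ... | no _     | yes _      = refl
  ... | no _     | no _       = refl

  inc-virtual : ∀ w x → inc 𝒮 w (inj₂ x) ≡ δ w (u x) * orientation x
  inc-virtual w x with w ≟ u x | dir x
  ... | yes _ | true  = refl
  ... | yes _ | false = refl
  ... | no _  | true  = refl
  ... | no _  | false = refl

  incidence-columns : ∀ {r} (ρ : Fin r → Fin n) → Injective _≡_ _≡_ ρ → (b : Fin r → Edge* 𝒮) →
    ∀ c → IsIncidenceColumn (λ i → inc 𝒮 (ρ i) (b c))
  incidence-columns ρ ρ-inj b c with b c
  ... | inj₁ l = IsIncidenceColumn-cong (λ i → sym (inc-edge (ρ i) l)) (IsIncidenceColumn-δ-difference ρ ρ-inj (loopless l))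
  ... | inj₂ x = IsIncidenceColumn-cong (λ i → sym (inc-virtual (ρ i) x)) (IsIncidenceColumn-δ ρ ρ-inj (u x) (orientation-unit x))

  row₂-injective : Injective _≡_ _≡_ (t ++ u)
  row₂-injective = ++-injective t u (t-inj _ _) (u-inj _ _) λ a x tₐ≡uₓ → u-notT x a (sym tₐ≡uₓ)

  row₂-avoids-S : ∀ r j → (t ++ u) r ≢ s j
  row₂-avoids-S r j = avoids (splitAt k r)
    where
    avoids : ∀ i → [ t , u ] i ≢ s j
    avoids (inj₁ a) tₐ≡sⱼ = ST-disj j a (sym tₐ≡sⱼ)
    avoids (inj₂ x)       = u-notS x j

  det-A₂-square : (B : CommonBase 𝒮) → det (A₂[_] 𝒮 (CommonBase.b B)) * det (A₂[_] 𝒮 (CommonBase.b B)) ≡ + 1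
  det-A₂-square B = square (det-incidence-unimodular (A₂[_] 𝒮 b) (incidence-columns (t ++ u) row₂-injective b))
    where
    open CommonBase B
    square : det (A₂[_] 𝒮 b) ≡ + 0 ⊎ IsUnit (det (A₂[_] 𝒮 b)) → det (A₂[_] 𝒮 b) * det (A₂[_] 𝒮 b) ≡ + 1
    square (inj₁ d≡0)  = ⊥-elim (nonsing₂ d≡0)
    square (inj₂ unit) = IsUnit⇒square≡1 unit

  potential-along-path : (P : DisjointSTPath 𝒮) (φ : Fin n → ℤ) →
    (∀ l → DisjointSTPath.inP P l → φ (tail l) ≡ φ (head l)) → ∀ j → φ (s j) ≡ φ (t (DisjointSTPath.σ P ⟨$⟩ʳ j))
  potential-along-path P φ φ-edge j = begin
    φ (s j)                    ≡⟨ cong φ (sym (start j)) ⟩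
    φ (vert j zero)            ≡⟨ walk-potential φ (len j) (vert j) step ⟩
    φ (vert j (fromℕ (len j))) ≡⟨ cong φ (end j) ⟩
    φ (t (σ ⟨$⟩ʳ j))           ∎
    where
    open ≡-Reasoning
    open DisjointSTPath P
    step : ∀ a → φ (vert j (inject₁ a)) ≡ φ (vert j (suc a))
    step a with adj j a
    ... | l , joins-l = along (φ-edge l (j , a , joins-l)) joins-l
      where
      along : ∀ {x y} → φ (tail l) ≡ φ (head l) → joins 𝒮 l x y → φ x ≡ φ y
      along φₗ (inj₁ (tail≡x , head≡y)) = trans (cong φ (sym tail≡x)) (trans φₗ (cong φ head≡y))
      along φₗ (inj₂ (tail≡y , head≡x)) = trans (cong φ (sym head≡x)) (trans (sym φₗ) (cong φ tail≡y))

  module PathInBase (P : DisjointSTPath 𝒮) (B : CommonBase 𝒮) (P⊆B : _⊆B_ 𝒮 P B) where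
    open DisjointSTPath P using (σ)
    open CommonBase B using (b)

    ι : Fin n → Vector ℤ (k ℕ.+ m)
    ι v c = inc 𝒮 v (b c)

    det-as-blocks : ∀ (ρ : Fin k → Fin n) → det (λ i c → inc 𝒮 ([ ρ , u ] (splitAt k i)) (b c)) ≡ det ((ι ∘ ρ) ++ (ι ∘ u))
    det-as-blocks ρ = det-cong _ ((ι ∘ ρ) ++ (ι ∘ u)) λ i c → cong-app ([,]-∘ ι (splitAt k i)) c

    A₂ : Matrix (k ℕ.+ m)
    A₂ = (ι ∘ t) ++ (ι ∘ u)

    d : ℤ
    d = det A₂

    d²≡1 : d * d ≡ + 1
    d²≡1 = subst (λ x → x * x ≡ + 1) (det-as-blocks t) (det-A₂-square B)

    ψ : Fin k → Vector ℤ (k ℕ.+ m)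
    ψ i r = det (A₂ [ r ]≔ ι (s i))

    ψ-vertex : Fin k → Fin n → ℤ
    ψ-vertex i v = ∑[ r < k ℕ.+ m ] (ψ i r * δ ((t ++ u) r) v)

    φ : Fin k → Fin n → ℤ
    φ i v = ψ-vertex i v - d * δ (s i) v

    φ-edge : ∀ i l → (∃ λ c → b c ≡ inj₁ l) → φ i (tail l) ≡ φ i (head l)
    φ-edge i l (c , bc≡l) = balance (ψ-vertex i (tail l)) (ψ-vertex i (head l)) (δ (s i) (tail l)) (δ (s i) (head l)) (begin
      ψ-vertex i (tail l) - ψ-vertex i (head l)
        ≡⟨ sym (∑-difference (λ r → ψ i r * δ ((t ++ u) r) (tail l)) (λ r → ψ i r * δ ((t ++ u) r) (head l))) ⟩
      ∑[ r < k ℕ.+ m ] (ψ i r * δ ((t ++ u) r) (tail l) - ψ i r * δ ((t ++ u) r) (head l))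
        ≡⟨ sum-cong-≗ (λ r → trans (sym (*-distribˡ-minus (ψ i r) _ _)) (cong (ψ i r *_) (column r))) ⟩
      ∑[ r < k ℕ.+ m ] (ψ i r * A₂ r c)
        ≡⟨ cramer A₂ (ι (s i)) c ⟩
      d * ι (s i) c
        ≡⟨ cong (d *_) (trans (cong (inc 𝒮 (s i)) bc≡l) (inc-edge (s i) l)) ⟩
      d * (δ (s i) (tail l) - δ (s i) (head l))
        ∎)
      where
      open ≡-Reasoning
      column : ∀ r → δ ((t ++ u) r) (tail l) - δ ((t ++ u) r) (head l) ≡ A₂ r c
      column r = trans (sym (inc-edge ((t ++ u) r) l))
                       (trans (cong (inc 𝒮 ((t ++ u) r)) (sym bc≡l)) (cong-app ([,]-∘ ι (splitAt k r)) c))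
      *-distribˡ-minus : ∀ a x y → a * (x - y) ≡ a * x - a * y
      *-distribˡ-minus = solve-∀
      balance : ∀ a b x y → a - b ≡ d * (x - y) → a - d * x ≡ b - d * y
      balance a b x y eq = trans (shift a b d x y) (trans (cong (λ z → z - d * (x - y) + (b - d * y)) eq) (cancel (d * (x - y)) b d y))
        where
        shift : ∀ a b d x y → a - d * x ≡ a - b - d * (x - y) + (b - d * y)
        shift = solve-∀
        cancel : ∀ z b d y → z - z + (b - d * y) ≡ b - d * y
        cancel = solve-∀

    ψ-vertex-S : ∀ i j → ψ-vertex i (s j) ≡ + 0
    ψ-vertex-S i j = sum-zero _ λ r → trans (cong (ψ i r *_) (δ-≢ (row₂-avoids-S r j))) (*-zeroʳ (ψ i r))

    ψ-vertex-T : ∀ i a → ψ-vertex i (t a) ≡ ψ i (a ↑ˡ m)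
    ψ-vertex-T i a = begin
      ψ-vertex i (t a)
        ≡⟨ sum-single _ (a ↑ˡ m) (λ r r≢a → trans (cong (ψ i r *_)
             (δ-≢ λ e → r≢a (row₂-injective (trans e (sym (lookup-++ˡ t u a)))))) (*-zeroʳ (ψ i r))) ⟩
      ψ i (a ↑ˡ m) * δ ((t ++ u) (a ↑ˡ m)) (t a)
        ≡⟨ cong (λ v → ψ i (a ↑ˡ m) * δ v (t a)) (lookup-++ˡ t u a) ⟩
      ψ i (a ↑ˡ m) * δ (t a) (t a)
        ≡⟨ trans (cong (ψ i (a ↑ˡ m) *_) (δ-refl (t a))) (*-identityʳ (ψ i (a ↑ˡ m))) ⟩
      ψ i (a ↑ˡ m)
        ∎
      where open ≡-Reasoning

    ψ-at-tσ : ∀ i j → ψ i (σ ⟨$⟩ʳ j ↑ˡ m) ≡ - (d * δ (s i) (s j))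
    ψ-at-tσ i j = begin
      ψ i (σ ⟨$⟩ʳ j ↑ˡ m)
        ≡⟨ sym (ψ-vertex-T i (σ ⟨$⟩ʳ j)) ⟩
      ψ-vertex i (t (σ ⟨$⟩ʳ j))
        ≡⟨ minus-zero (ψ-vertex i (t (σ ⟨$⟩ʳ j))) d ⟩
      ψ-vertex i (t (σ ⟨$⟩ʳ j)) - d * + 0
        ≡⟨ cong (λ z → ψ-vertex i (t (σ ⟨$⟩ʳ j)) - d * z) (sym (δ-≢ (ST-disj i _))) ⟩
      φ i (t (σ ⟨$⟩ʳ j))
        ≡⟨ sym (potential-along-path P (φ i) (λ l l∈P → φ-edge i l (P⊆B l l∈P)) j) ⟩
      φ i (s j)
        ≡⟨ cong (_- d * δ (s i) (s j)) (ψ-vertex-S i j) ⟩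
      + 0 - d * δ (s i) (s j)
        ≡⟨ zero-minus (d * δ (s i) (s j)) ⟩
      - (d * δ (s i) (s j))
        ∎
      where
      open ≡-Reasoning
      minus-zero : ∀ x d → x ≡ x - d * + 0
      minus-zero = solve-∀
      zero-minus : ∀ x → + 0 - x ≡ - x
      zero-minus = solve-∀

    T-rows-contribution : ∀ i c → ∑[ a < k ] (ψ i (a ↑ˡ m) * A₂ (a ↑ˡ m) c) ≡ - d * ι (t (σ ⟨$⟩ʳ i)) c
    T-rows-contribution i c = begin
      ∑[ a < k ] (ψ i (a ↑ˡ m) * A₂ (a ↑ˡ m) c)
        ≡⟨ sum-cong-≗ (λ a → cong (λ row → ψ i (a ↑ˡ m) * row c) (lookup-++ˡ (ι ∘ t) (ι ∘ u) a)) ⟩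
      ∑[ a < k ] (ψ i (a ↑ˡ m) * ι (t a) c)
        ≡⟨ ∑-permute (λ a → ψ i (a ↑ˡ m) * ι (t a) c) σ ⟩
      ∑[ j < k ] (ψ i (σ ⟨$⟩ʳ j ↑ˡ m) * ι (t (σ ⟨$⟩ʳ j)) c)
        ≡⟨ sum-cong-≗ (λ j → cong (_* ι (t (σ ⟨$⟩ʳ j)) c) (ψ-at-tσ i j)) ⟩
      ∑[ j < k ] (- (d * δ (s i) (s j)) * ι (t (σ ⟨$⟩ʳ j)) c)
        ≡⟨ sum-single _ i (λ j j≢i → trans
             (cong (λ z → - (d * z) * ι (t (σ ⟨$⟩ʳ j)) c) (δ-≢ λ e → j≢i (sym (s-inj i j e))))
             (vanish d (ι (t (σ ⟨$⟩ʳ j)) c))) ⟩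
      - (d * δ (s i) (s i)) * ι (t (σ ⟨$⟩ʳ i)) c
        ≡⟨ cong (λ z → - (d * z) * ι (t (σ ⟨$⟩ʳ i)) c) (δ-refl (s i)) ⟩
      - (d * + 1) * ι (t (σ ⟨$⟩ʳ i)) c
        ≡⟨ cong (λ z → - z * ι (t (σ ⟨$⟩ʳ i)) c) (*-identityʳ d) ⟩
      - d * ι (t (σ ⟨$⟩ʳ i)) c
        ∎
      where
      open ≡-Reasoning
      vanish : ∀ d x → - (d * + 0) * x ≡ + 0
      vanish = solve-∀

    scaled-s-row-relation : ∀ i c → d * ι (s i) c ≡ - d * ι (t (σ ⟨$⟩ʳ i)) c + ∑[ x < m ] (ψ i (k ↑ʳ x) * ι (u x) c)
    scaled-s-row-relation i c = begin
      d * ι (s i) c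
        ≡⟨ sym (cramer A₂ (ι (s i)) c) ⟩
      ∑[ r < k ℕ.+ m ] (ψ i r * A₂ r c)
        ≡⟨ sum-split {k} {m} (λ r → ψ i r * A₂ r c) ⟩
      ∑[ a < k ] (ψ i (a ↑ˡ m) * A₂ (a ↑ˡ m) c) + ∑[ x < m ] (ψ i (k ↑ʳ x) * A₂ (k ↑ʳ x) c)
        ≡⟨ cong₂ _+_ (T-rows-contribution i c)
                     (sum-cong-≗ λ x → cong (λ row → ψ i (k ↑ʳ x) * row c) (lookup-++ʳ (ι ∘ t) (ι ∘ u) x)) ⟩
      - d * ι (t (σ ⟨$⟩ʳ i)) c + ∑[ x < m ] (ψ i (k ↑ʳ x) * ι (u x) c)
        ∎
      where open ≡-Reasoning

    s-row-relation : ∀ i c → ι (s i) c ≡ - + 1 * ι (t (σ ⟨$⟩ʳ i)) c + ∑[ x < m ] (d * ψ i (k ↑ʳ x) * ι (u x) c)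
    s-row-relation i c = begin
      ι (s i) c
        ≡⟨ unit-cancel {d} {ι (s i) c} {T} {S} d²≡1 (scaled-s-row-relation i c) ⟩
      - + 1 * T + d * S
        ≡⟨ cong (_+_ (- + 1 * T)) (trans (*-distribˡ-sum d (λ x → ψ i (k ↑ʳ x) * ι (u x) c))
                                         (sum-cong-≗ λ x → sym (*-assoc d (ψ i (k ↑ʳ x)) (ι (u x) c)))) ⟩
      - + 1 * T + ∑[ x < m ] (d * ψ i (k ↑ʳ x) * ι (u x) c)
        ∎
      where
      open ≡-Reasoning
      T S : ℤ
      T = ι (t (σ ⟨$⟩ʳ i)) c
      S = ∑[ x < m ] (ψ i (k ↑ʳ x) * ι (u x) c)

    det-A₁ : det (A₁[_] 𝒮 b) ≡ negOnePow k * (sgnPerm σ * det (A₂[_] 𝒮 b))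
    det-A₁ = begin
      det (A₁[_] 𝒮 b)
        ≡⟨ det-as-blocks s ⟩
      det ((ι ∘ s) ++ (ι ∘ u))
        ≡⟨ det-replace-block (- + 1) (ι ∘ s) (ι ∘ t ∘ (σ ⟨$⟩ʳ_)) (ι ∘ u)
             (λ i x → d * ψ i (k ↑ʳ x)) s-row-relation ⟩
      (- + 1) ^ k * det ((ι ∘ t ∘ (σ ⟨$⟩ʳ_)) ++ (ι ∘ u))
        ≡⟨ cong₂ _*_ (sym (negOnePow≡-1^ k)) (det-permute-block σ (ι ∘ t) (ι ∘ u)) ⟩
      negOnePow k * (sgnPerm σ * d)
        ≡⟨ cong (λ x → negOnePow k * (sgnPerm σ * x)) (sym (det-as-blocks t)) ⟩
      negOnePow k * (sgnPerm σ * det (A₂[_] 𝒮 b))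
        ∎
      where open ≡-Reasoning

lemma4p7 : (𝒮 : Setting) (P : DisjointSTPath 𝒮) (B : CommonBase 𝒮) → _⊆B_ 𝒮 P B →
    DisjointSTPath.sgn P
    ≡ negOnePow (Setting.k 𝒮) *ℤ (det (A₁[_] 𝒮 (CommonBase.b B)) *ℤ det (A₂[_] 𝒮 (CommonBase.b B)))
lemma4p7 𝒮 P B P⊆B = sym (begin
  negOnePow k * (det₁ * det₂)
    ≡⟨ cong (λ x → negOnePow k * (x * det₂)) (PathInBase.det-A₁ 𝒮 P B P⊆B) ⟩
  negOnePow k * (negOnePow k * (sgnPerm σ * det₂) * det₂)
    ≡⟨ regroup (negOnePow k) (sgnPerm σ) det₂ ⟩
  negOnePow k * negOnePow k * (sgnPerm σ * (det₂ * det₂))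
    ≡⟨ cong₂ (λ x y → x * (sgnPerm σ * y)) (IsUnit⇒square≡1 (IsUnit-negOnePow k)) (det-A₂-square 𝒮 B) ⟩
  + 1 * (sgnPerm σ * + 1)
    ≡⟨ unit-factors (sgnPerm σ) ⟩
  sgnPerm σ
    ∎)
  where
  open ≡-Reasoning
  open Setting 𝒮 using (k)
  open DisjointSTPath P using (σ)
  det₁ det₂ : ℤ
  det₁ = det (A₁[_] 𝒮 (CommonBase.b B))
  det₂ = det (A₂[_] 𝒮 (CommonBase.b B))
  regroup : ∀ e g d → e * (e * (g * d) * d) ≡ e * e * (g * (d * d))
  regroup = solve-∀
  unit-factors : ∀ g → + 1 * (g * + 1) ≡ g
  unit-factors = solve-∀
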